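{- Let $X$ be a non-empty finite set and let $\mathcal{R}$ be a rooted (binary) phylogenetic network on $X$. Then $\mathcal{R}$ is tree-child if and only if there exists a complete tree-child cherry-picking sequence for $\mathcal{R}$ (i.e. a tree-child cherry-picking sequence associated with a complete cherry-reduction sequence for $\mathcal{R}$).
   Context: A rooted (binary) phylogenetic network on $X$ is a directed acyclic graph with no loops and no parallel arcs such that: (i) there is a unique vertex $\rho$ (the root) with in-degree 0 and out-degree 2; (ii) every vertex of out-degree 0 has in-degree 1, and the set of out-degree-0 vertices (leaves) is $X$; (iii) every other vertex has either in-degree 1 and out-degree 2 (a tree vertex) or in-degree 2 and out-degree 1 (a reticulation). If $|X|=1$, the single isolated vertex labelled by the element of $X$ is also a rooted phylogenetic network, and it is its own root. For a leaf $a$, $p_a$ denotes its unique parent. The reticulation number $r(\mathcal{R})$ is the number of reticulations. A rooted phylogenetic network is tree-child if every non-leaf vertex has a child that is a tree vertex or a leaf (equivalently, no two reticulations are joined by an arc and no two reticulations share a parent). For distinct $a,b\in X$: $[a,b]$ is a cherry of $\mathcal{R}$ if $p_a=p_b$; $(a,b)$ is a reticulated cherry (with reticulation leaf $a$) if $p_a$ is a reticulation and $(p_b,p_a)$ is an arc. Reducing the cherry $[a,b]$ means deleting $a$ and suppressing the resulting degree-2 vertex if $p_a\neq\rho$, and deleting $a$ and $p_a$ if $p_a=\rho$. Reducing the reticulated cherry $(a,b)$ means deleting the arc $(p_b,p_a)$ and suppressing the two resulting degree-2 vertices. These operations are cherry reductions. A cherry-reduction sequence for $\mathcal{R}$ is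 a sequence $(\mathcal{R}=\mathcal{R}_0,\mathcal{R}_1,\ldots,\mathcal{R}_k)$ where each $\mathcal{R}_i$ is obtained from $\mathcal{R}_{i-1}$ by a cherry reduction; it is complete if $\mathcal{R}_k$ is a single vertex (then $k=|X|+r(\mathcal{R})-1$). The cherry-picking sequence associated with it is $(r_1,\ldots,r_k)$, where $r_i=[x_i,y_i]$ if $\mathcal{R}_i$ is obtained by reducing the cherry $[x_i,y_i]$ and $r_i=(x_i,y_i)$ if it is obtained by reducing the reticulated cherry $(x_i,y_i)$; such a sequence is a cherry-picking sequence for $\mathcal{R}$, and it is complete if $k=|X|+r(\mathcal{R})-1$. We say $r_i$ contains $x_i$ and $y_i$. For a cherry-picking sequence $\Sigma=(r_1,\ldots,r_k)$ and $i\in\{1,\ldots,k\}$, let $s(i)$ be the smallest $j\in\{i+1,\ldots,k\}$ such that $r_j$ contains $x_i$ (the first coordinate of $r_i$), with $s(i)=\infty$ if no such $j$ exists; if $s(i)\neq\infty$, $S(i)=r_{s(i)}$ is the successor pair of $r_i$. $\Sigma$ is tree-child if (P1) for every $i$ with $r_i=(x_i,y_i)$ and $s(i)=j\neq\infty$, $S(i)$ is of the form $[x_j,y_j]$ (a cherry pair); and (P2) for any two distinct $i,j$ with $r_i=(x_i,y_i)$, $r_j=(x_j,y_j)$, $s(i)\neq\infty$, $s(j)\neq\infty$, we have $s(i)\neq s(j)$. -}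

module Defs where

open import Data.Nat using (ℕ; _≟_)
open import Data.Product using (Σ; ∃; ∃-syntax; _×_; _,_; proj₁; proj₂)
open import Data.Sum using (_⊎_)
open import Data.List using (List; []; _∷_; length; filter)
open import Data.List.Membership.Propositional using (_∈_)
open import Data.List.Relation.Unary.Unique.Propositional using (Unique)
open import Data.Fin using (Fin; toℕ)
open import Data.List using (lookup)
open import Relation.Nullary using (¬_)
open import Relation.Binary.PropositionalEquality using (_≡_; _≢_)
open import Data.Empty using (⊥)
open import Data.Nat using (_<_)
open import Function.Bundles using (_⇔_)

-- Directed graphs with vertices named by natural numbers.
-- Leaves are labelled by their own vertex name, so the leaf set X
-- is a finite set of natural numbers.

Arc : Set
Arc = ℕ × ℕ

record Graph : Set where
  constructor graph
  field
    V : List ℕ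
    A : List Arc
open Graph public

indeg : Graph → ℕ → ℕ
indeg G v = length (filter (λ e → proj₂ e ≟ v) (A G))

outdeg : Graph → ℕ → ℕ
outdeg G v = length (filter (λ e → proj₁ e ≟ v) (A G))

data Path (G : Graph) : ℕ → ℕ → Set where
  arc  : ∀ {u v} → (u , v) ∈ A G → Path G u v
  _∷ₚ_ : ∀ {u v w} → (u , v) ∈ A G → Path G v w → Path G u w

Acyclic : Graph → Set
Acyclic G = ∀ v → ¬ Path G v v

NoLoops : Graph → Set
NoLoops G = ∀ u v → (u , v) ∈ A G → u ≢ v

ArcsInV : Graph → Set
ArcsInV G = ∀ u v → (u , v) ∈ A G → (u ∈ V G) × (v ∈ V G)

SingleVertex : Graph → Set
SingleVertex G = ∃[ x ] (V G ≡ x ∷ []) × (A G ≡ [])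

IsLeaf IsTreeVertex IsReticulation : Graph → ℕ → Set
IsLeaf G v = (v ∈ V G) × (indeg G v ≡ 1) × (outdeg G v ≡ 0)
IsTreeVertex G v = (v ∈ V G) × (indeg G v ≡ 1) × (outdeg G v ≡ 2)
IsReticulation G v = (v ∈ V G) × (indeg G v ≡ 2) × (outdeg G v ≡ 1)

IsRootVertex : Graph → ℕ → Set
IsRootVertex G v = (v ∈ V G) × (indeg G v ≡ 0) × (outdeg G v ≡ 2)

-- conditions (i)-(iii): a root rho, and every other vertex is a leaf,
-- a tree vertex or a reticulation (which forces uniqueness of the root)
BinaryConditions : Graph → Set
BinaryConditions G =
  ∃[ ρ ] IsRootVertex G ρ ×
    (∀ v → v ∈ V G → v ≢ ρ →
       IsLeaf G v ⊎ IsTreeVertex G v ⊎ IsReticulation G v)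

IsNetwork : Graph → Set
IsNetwork G =
  Unique (V G) × Unique (A G) × ArcsInV G × NoLoops G × Acyclic G ×
  (SingleVertex G ⊎ BinaryConditions G)

IsNetworkOn : List ℕ → Graph → Set
IsNetworkOn X G =
  IsNetwork G × Unique X × (∀ x → (x ∈ X) ⇔ ((x ∈ V G) × (outdeg G x ≡ 0)))

IsTreeChild : Graph → Set
IsTreeChild G =
  ∀ v → v ∈ V G → ¬ (outdeg G v ≡ 0) →
    ∃[ u ] ((v , u) ∈ A G) × (IsTreeVertex G u ⊎ IsLeaf G u)

NotIncident : ℕ → ℕ → Arc → Set
NotIncident x y e =
  (proj₁ e ≢ x) × (proj₂ e ≢ x) × (proj₁ e ≢ y) × (proj₂ e ≢ y)

-- reducing the cherry [a,b]: delete a, suppress p = p_a = p_b if p ≠ ρ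
-- (replace arcs (g,p),(p,b) by (g,b)); delete a and p if p = ρ.
ReduceCherry : Graph → ℕ → ℕ → Graph → Set
ReduceCherry G a b G' =
  (a ≢ b) × IsLeaf G a × IsLeaf G b × Unique (V G') × Unique (A G') ×
  ∃[ p ] ((p , a) ∈ A G) × ((p , b) ∈ A G) ×
    (∀ x → (x ∈ V G') ⇔ ((x ∈ V G) × (x ≢ a) × (x ≢ p))) ×
    ( (
        (indeg G p ≡ 0) ×
        (∀ e → (e ∈ A G') ⇔ ((e ∈ A G) × NotIncident a p e)) )
    ⊎ (
        ∃[ g ] ((g , p) ∈ A G) ×
        (∀ e → (e ∈ A G') ⇔ (((e ∈ A G) × NotIncident a p e) ⊎ (e ≡ (g , b))))))

-- reducing the reticulated cherry (a,b): delete the arc (p_b,p_a) and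
-- suppress p_b (parent g, child b) and p_a (other parent q, child a).
ReduceRetCherry : Graph → ℕ → ℕ → Graph → Set
ReduceRetCherry G a b G' =
  (a ≢ b) × IsLeaf G a × IsLeaf G b × Unique (V G') × Unique (A G') ×
  ∃[ pa ] ∃[ pb ] ∃[ q ] ∃[ g ]
    ((pa , a) ∈ A G) × ((pb , b) ∈ A G) × IsReticulation G pa ×
    ((pb , pa) ∈ A G) × ((q , pa) ∈ A G) × (q ≢ pb) × ((g , pb) ∈ A G) ×
    (∀ x → (x ∈ V G') ⇔ ((x ∈ V G) × (x ≢ pa) × (x ≢ pb))) ×
    (∀ e → (e ∈ A G') ⇔
       (((e ∈ A G) × NotIncident pa pb e) ⊎ (e ≡ (g , b)) ⊎ (e ≡ (q , a))))

data CPair : Set where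
  cherry : ℕ → ℕ → CPair
  ret    : ℕ → ℕ → CPair

first : CPair → ℕ
first (cherry x _) = x
first (ret x _) = x

Contains : CPair → ℕ → Set
Contains (cherry x y) z = (z ≡ x) ⊎ (z ≡ y)
Contains (ret x y) z = (z ≡ x) ⊎ (z ≡ y)

IsCherryPair IsRetPair : CPair → Set
IsCherryPair p = ∃[ x ] ∃[ y ] (p ≡ cherry x y)
IsRetPair p = ∃[ x ] ∃[ y ] (p ≡ ret x y)

Reduction : Graph → CPair → Graph → Set
Reduction G (cherry a b) G' = ReduceCherry G a b G'
Reduction G (ret a b) G' = ReduceRetCherry G a b G'

-- a complete cherry-reduction sequence starting at G, recorded by its
-- associated cherry-picking sequence: each step is a cherry reduction and
-- the final network is a single vertex.
data CompleteReduction : Graph → List CPair → Set where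
  done : ∀ {G} → SingleVertex G → CompleteReduction G []
  step : ∀ {G G' r rs} → Reduction G r G' → CompleteReduction G' rs →
         CompleteReduction G (r ∷ rs)

IsSucc : (S : List CPair) → Fin (length S) → Fin (length S) → Set
IsSucc S i j =
  (toℕ i < toℕ j) × Contains (lookup S j) (first (lookup S i)) ×
  (∀ k → toℕ i < toℕ k → toℕ k < toℕ j →
     ¬ Contains (lookup S k) (first (lookup S i)))

TreeChildSeq : List CPair → Set
TreeChildSeq S =
  (∀ i j → IsRetPair (lookup S i) → IsSucc S i j → IsCherryPair (lookup S j)) ×
  (∀ i i' j → i ≢ i' → IsRetPair (lookup S i) → IsRetPair (lookup S i') →
     IsSucc S i j → IsSucc S i' j → ⊥)

-- Cherry reductions preserve being a network and being tree-child, and a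
-- tree-child network always has a reducible pair: descending from the root
-- through tree vertices one meets a vertex whose children are two leaves
-- (a cherry) or a leaf and a reticulation above a leaf (a reticulated cherry).
-- This yields a complete reduction sequence.
--
-- For the sequence conditions, look at the first pair of a complete sequence
-- containing a leaf a. If the parent q of a has a second child, a tree vertex
-- or a leaf, that pair is a cherry and not the successor of a reticulated
-- pair; if q or a sibling of a is a reticulation, it is one of the two (a
-- "conflict" at a). In a tree-child network the first situation holds for the
-- reticulation leaf of every reticulated cherry, so every complete sequence
-- satisfies (P1) and (P2). Conversely, if a step bypasses a reticulation below
-- a vertex v, tree-childness of the reduced network and the absence of a
-- conflict at the bypassing reticulation leaf give v a tree or leaf child, so
-- tree-childness propagates back along the sequence.

module Submission where

open import Defs
open import Data.Nat using (ℕ; zero; suc; _≤_; _<_; _+_; z≤n; s≤s; _≟_)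
open import Data.Nat.Properties using (≤-refl; ≤-trans; ≤-antisym; ≤-pred; <-irrefl; n<1+n; +-suc; +-identityʳ)
open import Data.Fin using (Fin; toℕ) renaming (zero to fzero; suc to fsuc)
open import Data.Fin.Properties using (suc-injective)
open import Data.Product using (∃; ∃-syntax; _×_; _,_; proj₁; proj₂)
open import Data.Product.Properties using (≡-dec; ,-injective; ,-injectiveˡ; ,-injectiveʳ)
open import Data.Sum using (_⊎_; inj₁; inj₂)
open import Data.Empty using (⊥; ⊥-elim)
open import Data.List using (List; []; _∷_; length; filter; map; lookup)
open import Data.List.Properties using (filter-notAll; length-map)
open import Data.List.Membership.Propositional using (_∈_; _∉_)
open import Data.List.Membership.Propositional.Properties using (∈-filter⁺; ∈-filter⁻; ∈-map⁺; ∈-map⁻)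
open import Data.List.Membership.DecPropositional _≟_ using (_∈?_)
open import Data.List.Relation.Binary.Subset.Propositional using (_⊆_)
open import Data.List.Relation.Unary.Any using (here; there)
import Data.List.Relation.Unary.Any as Any
open import Data.List.Relation.Unary.All using ([]; _∷_)
import Data.List.Relation.Unary.All as All
open import Data.List.Relation.Unary.All.Properties using (map⁺; ¬Any⇒All¬)
open import Data.List.Relation.Unary.Unique.Propositional using (Unique; []; _∷_)
open import Data.List.Relation.Unary.Unique.Propositional.Properties using (filter⁺)
open import Function using (case_of_)
open import Function.Bundles using (_⇔_; Equivalence; mk⇔)
open import Function.Construct.Identity using (⇔-id)
open import Relation.Binary.Definitions using (DecidableEquality)
open import Relation.Binary.PropositionalEquality using (_≡_; _≢_; refl; sym; trans; subst; cong)
open import Relation.Nullary using (¬_; Dec; yes; no)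
open import Relation.Nullary.Decidable using (¬?; _⊎-dec_; _×-dec_)

open Equivalence using (to; from)

module _ {A : Set} (_≟ᴬ_ : DecidableEquality A) where

  unique-length-≤ : {xs ys : List A} → Unique xs → xs ⊆ ys → length xs ≤ length ys
  unique-length-≤ {[]} _ _ = z≤n
  unique-length-≤ {x ∷ xs} {ys} (x∉xs ∷ u) xs⊆ys =
    ≤-trans (s≤s (unique-length-≤ u xs⊆ys-x)) (filter-notAll ≢x? ys (Any.map (λ x≡y y≢x → y≢x (sym x≡y)) (xs⊆ys (here refl))))
    where
    ≢x? : (y : A) → Dec (y ≢ x)
    ≢x? = λ y → ¬? (y ≟ᴬ x)
    xs⊆ys-x : xs ⊆ filter ≢x? ys
    xs⊆ys-x y∈xs = ∈-filter⁺ ≢x? (xs⊆ys (there y∈xs)) (λ y≡x → All.lookup x∉xs y∈xs (sym y≡x))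

  unique-length-≡ : {xs ys : List A} → Unique xs → Unique ys → xs ⊆ ys → ys ⊆ xs → length xs ≡ length ys
  unique-length-≡ uxs uys xs⊆ys ys⊆xs = ≤-antisym (unique-length-≤ uxs xs⊆ys) (unique-length-≤ uys ys⊆xs)

map-unique : {A B : Set} {f : A → B} {xs : List A} →
  (∀ {x y} → x ∈ xs → y ∈ xs → f x ≡ f y → x ≡ y) → Unique xs → Unique (map f xs)
map-unique {xs = []} inj [] = []
map-unique {xs = x ∷ xs} inj (x∉xs ∷ u) =
  map⁺ (All.tabulate (λ y∈xs fx≡fy → All.lookup x∉xs y∈xs (inj (here refl) (there y∈xs) fx≡fy)))
  ∷ map-unique (λ x∈ y∈ → inj (there x∈) (there y∈)) u

unique-singleton : {A : Set} {x : A} {xs : List A} → Unique xs → (∀ {y} → y ∈ xs → y ≡ x) → x ∈ xs → xs ≡ x ∷ []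
unique-singleton {xs = y ∷ []} _ all≡x _ = subst (λ z → z ∷ [] ≡ _) (sym (all≡x (here refl))) refl
unique-singleton {xs = y ∷ z ∷ _} ((y≢z ∷ _) ∷ _) all≡x _ = ⊥-elim (y≢z (trans (all≡x (here refl)) (sym (all≡x (there (here refl))))))

record Enumerates {A : Set} (P : A → Set) (xs : List A) : Set where
  field
    unique   : Unique xs
    sound    : ∀ {x} → x ∈ xs → P x
    complete : ∀ {x} → P x → x ∈ xs
open Enumerates public

module _ {P : ℕ → Set} where

  enum-length≡0 : ∀ {xs x} → Enumerates P xs → length xs ≡ 0 → ¬ P x
  enum-length≡0 {[]} e _ px with complete e px
  ... | ()

  enum-length≡1 : ∀ {xs x y} → Enumerates P xs → length xs ≡ 1 → P x → P y → x ≡ y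
  enum-length≡1 {_ ∷ []} e _ px py with complete e px | complete e py
  ... | here refl | here refl = refl

  enum-length≡2 : ∀ {xs x y z} → Enumerates P xs → length xs ≡ 2 → P x → P y → x ≢ y → P z → z ≡ x ⊎ z ≡ y
  enum-length≡2 {_ ∷ _ ∷ []} e _ px py x≢y pz with complete e px | complete e py | complete e pz
  ... | here refl         | here refl         | _                 = ⊥-elim (x≢y refl)
  ... | there (here refl) | there (here refl) | _                 = ⊥-elim (x≢y refl)
  ... | here refl         | there (here refl) | here refl         = inj₁ refl
  ... | here refl         | there (here refl) | there (here refl) = inj₂ refl
  ... | there (here refl) | here refl         | here refl         = inj₂ refl
  ... | there (here refl) | here refl         | there (here refl) = inj₁ refl

  enum-length≡2-other : ∀ {xs x} → Enumerates P xs → length xs ≡ 2 → P x → ∃ λ y → P y × y ≢ x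
  enum-length≡2-other {c ∷ d ∷ []} e _ px with unique e | complete e px
  ... | (c≢d ∷ []) ∷ _ | here refl         = d , sound e (there (here refl)) , λ d≡c → c≢d (sym d≡c)
  ... | (c≢d ∷ []) ∷ _ | there (here refl) = c , sound e (here refl) , c≢d

  enum-length≡suc : ∀ {xs n} → Enumerates P xs → length xs ≡ suc n → ∃ P
  enum-length≡suc {c ∷ _} e _ = c , sound e (here refl)

  enum-2≤length : ∀ {xs x y} → Enumerates P xs → P x → P y → x ≢ y → 2 ≤ length xs
  enum-2≤length {xs} {x} {y} e px py x≢y = unique-length-≤ _≟_ ((x≢y ∷ []) ∷ [] ∷ []) pair⊆xs
    where
    pair⊆xs : x ∷ y ∷ [] ⊆ xs
    pair⊆xs (here refl) = complete e px
    pair⊆xs (there (here refl)) = complete e py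

replace : ℕ → ℕ → ℕ → ℕ
replace p t w with w ≟ p
... | yes _ = t
... | no _  = w

replace-≡ : ∀ p t → replace p t p ≡ t
replace-≡ p t with p ≟ p
... | yes _  = refl
... | no p≢p = ⊥-elim (p≢p refl)

replace-≢ : ∀ {p t w} → w ≢ p → replace p t w ≡ w
replace-≢ {p} {t} {w} w≢p with w ≟ p
... | yes w≡p = ⊥-elim (w≢p w≡p)
... | no _    = refl

enum-replace : ∀ {P Q : ℕ → Set} {xs p t} → Enumerates P xs → (P p → ¬ P t) →
  (∀ {w} → Q w ⇔ ((P w × w ≢ p) ⊎ (P p × w ≡ t))) → ∃ λ ys → Enumerates Q ys × length ys ≡ length xs
enum-replace {P} {Q} {xs} {p} {t} e p⇒¬t Q⇔ = map (replace p t) xs , record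
  { unique   = map-unique injective (unique e)
  ; sound    = λ w∈ → let c , c∈ , w≡ = ∈-map⁻ (replace p t) w∈ in subst Q (sym w≡) (sound′ c∈)
  ; complete = λ qw → complete′ (to Q⇔ qw)
  } , length-map (replace p t) xs
  where
  injective : ∀ {x y} → x ∈ xs → y ∈ xs → replace p t x ≡ replace p t y → x ≡ y
  injective {x} {y} x∈ y∈ eq with x ≟ p | y ≟ p
  ... | yes refl | yes refl = refl
  ... | yes refl | no _     = ⊥-elim (p⇒¬t (sound e x∈) (subst P (sym eq) (sound e y∈)))
  ... | no _     | yes refl = ⊥-elim (p⇒¬t (sound e y∈) (subst P eq (sound e x∈)))
  ... | no _     | no _     = eq
  sound′ : ∀ {c} → c ∈ xs → Q (replace p t c)
  sound′ {c} c∈ with c ≟ p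
  ... | yes refl = from Q⇔ (inj₂ (sound e c∈ , refl))
  ... | no c≢p   = from Q⇔ (inj₁ (sound e c∈ , c≢p))
  complete′ : ∀ {w} → (P w × w ≢ p) ⊎ (P p × w ≡ t) → w ∈ map (replace p t) xs
  complete′ (inj₁ (pw , w≢p)) = subst (_∈ map (replace p t) xs) (replace-≢ w≢p) (∈-map⁺ (replace p t) (complete e pw))
  complete′ (inj₂ (pp , refl)) = subst (_∈ map (replace p t) xs) (replace-≡ p t) (∈-map⁺ (replace p t) (complete e pp))

Edge : Graph → ℕ → ℕ → Set
Edge G u v = (u , v) ∈ A G

Children Parents : Graph → ℕ → List ℕ → Set
Children G u = Enumerates (Edge G u)
Parents G v = Enumerates (λ u → Edge G u v)

module Degrees (G : Graph) (uniqueA : Unique (A G)) where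

  private
    from? : ∀ u (e : Arc) → Dec (proj₁ e ≡ u)
    from? u e = proj₁ e ≟ u
    into? : ∀ v (e : Arc) → Dec (proj₂ e ≡ v)
    into? v e = proj₂ e ≟ v

  outdeg-enumerates : ∀ {u cs} → Children G u cs → outdeg G u ≡ length cs
  outdeg-enumerates {u} {cs} e =
    trans (unique-length-≡ (≡-dec _≟_ _≟_) (filter⁺ _ uniqueA) (map-unique (λ _ _ → ,-injectiveʳ) (unique e)) out⊆ ⊆out)
          (length-map (u ,_) cs)
    where
    out⊆ : filter (from? u) (A G) ⊆ map (u ,_) cs
    out⊆ {_ , w} e∈ with ∈-filter⁻ (from? u) {xs = A G} e∈
    ... | uw , refl = ∈-map⁺ (u ,_) (complete e uw)
    ⊆out : map (u ,_) cs ⊆ filter (from? u) (A G)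
    ⊆out e∈ with ∈-map⁻ (u ,_) e∈
    ... | w , w∈ , refl = ∈-filter⁺ (from? u) (sound e w∈) refl

  indeg-enumerates : ∀ {v ps} → Parents G v ps → indeg G v ≡ length ps
  indeg-enumerates {v} {ps} e =
    trans (unique-length-≡ (≡-dec _≟_ _≟_) (filter⁺ _ uniqueA) (map-unique (λ _ _ → ,-injectiveˡ) (unique e)) in⊆ ⊆in)
          (length-map (_, v) ps)
    where
    in⊆ : filter (into? v) (A G) ⊆ map (_, v) ps
    in⊆ {u , _} e∈ with ∈-filter⁻ (into? v) {xs = A G} e∈
    ... | uv , refl = ∈-map⁺ (_, v) (complete e uv)
    ⊆in : map (_, v) ps ⊆ filter (into? v) (A G)
    ⊆in e∈ with ∈-map⁻ (_, v) e∈
    ... | u , u∈ , refl = ∈-filter⁺ (into? v) (sound e u∈) refl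

  children : ∀ u → ∃ (Children G u)
  children u = map proj₂ (filter (from? u) (A G)) , record
    { unique   = map-unique same-source (filter⁺ _ uniqueA)
    ; sound    = λ w∈ → let e , e∈ , w≡ = ∈-map⁻ proj₂ w∈ in edge e∈ w≡
    ; complete = λ uw → ∈-map⁺ proj₂ (∈-filter⁺ (from? u) uw refl)
    }
    where
    same-source : ∀ {e f} → e ∈ filter (from? u) (A G) → f ∈ filter (from? u) (A G) → proj₂ e ≡ proj₂ f → e ≡ f
    same-source {_ , _} {_ , _} e∈ f∈ refl with ∈-filter⁻ (from? u) {xs = A G} e∈ | ∈-filter⁻ (from? u) {xs = A G} f∈
    ... | _ , refl | _ , refl = refl
    edge : ∀ {e w} → e ∈ filter (from? u) (A G) → w ≡ proj₂ e → Edge G u w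
    edge {_ , _} e∈ refl with ∈-filter⁻ (from? u) {xs = A G} e∈
    ... | uw , refl = uw

  parents : ∀ v → ∃ (Parents G v)
  parents v = map proj₁ (filter (into? v) (A G)) , record
    { unique   = map-unique same-target (filter⁺ _ uniqueA)
    ; sound    = λ u∈ → let e , e∈ , u≡ = ∈-map⁻ proj₁ u∈ in edge e∈ u≡
    ; complete = λ uv → ∈-map⁺ proj₁ (∈-filter⁺ (into? v) uv refl)
    }
    where
    same-target : ∀ {e f} → e ∈ filter (into? v) (A G) → f ∈ filter (into? v) (A G) → proj₁ e ≡ proj₁ f → e ≡ f
    same-target {_ , _} {_ , _} e∈ f∈ refl with ∈-filter⁻ (into? v) {xs = A G} e∈ | ∈-filter⁻ (into? v) {xs = A G} f∈
    ... | _ , refl | _ , refl = refl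
    edge : ∀ {e u} → e ∈ filter (into? v) (A G) → u ≡ proj₁ e → Edge G u v
    edge {_ , _} e∈ refl with ∈-filter⁻ (into? v) {xs = A G} e∈
    ... | uv , refl = uv

  private
    children-length : ∀ {u n} → outdeg G u ≡ n → length (proj₁ (children u)) ≡ n
    children-length {u} o = trans (sym (outdeg-enumerates (proj₂ (children u)))) o
    parents-length : ∀ {v n} → indeg G v ≡ n → length (proj₁ (parents v)) ≡ n
    parents-length {v} i = trans (sym (indeg-enumerates (proj₂ (parents v)))) i

  no-child : ∀ {v w} → outdeg G v ≡ 0 → ¬ Edge G v w
  no-child {v} o = enum-length≡0 (proj₂ (children v)) (children-length o)

  no-parent : ∀ {u v} → indeg G v ≡ 0 → ¬ Edge G u v
  no-parent {v = v} i = enum-length≡0 (proj₂ (parents v)) (parents-length i)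

  unique-child : ∀ {v w w′} → outdeg G v ≡ 1 → Edge G v w → Edge G v w′ → w ≡ w′
  unique-child {v} o = enum-length≡1 (proj₂ (children v)) (children-length o)

  unique-parent : ∀ {u u′ v} → indeg G v ≡ 1 → Edge G u v → Edge G u′ v → u ≡ u′
  unique-parent {v = v} i = enum-length≡1 (proj₂ (parents v)) (parents-length i)

  only-children : ∀ {v w₁ w₂ w} → outdeg G v ≡ 2 → Edge G v w₁ → Edge G v w₂ → w₁ ≢ w₂ → Edge G v w → w ≡ w₁ ⊎ w ≡ w₂
  only-children {v} o = enum-length≡2 (proj₂ (children v)) (children-length o)

  only-parents : ∀ {v u₁ u₂ u} → indeg G v ≡ 2 → Edge G u₁ v → Edge G u₂ v → u₁ ≢ u₂ → Edge G u v → u ≡ u₁ ⊎ u ≡ u₂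
  only-parents {v} i = enum-length≡2 (proj₂ (parents v)) (parents-length i)

  other-child : ∀ {v w} → outdeg G v ≡ 2 → Edge G v w → ∃ λ w′ → Edge G v w′ × w′ ≢ w
  other-child {v} o = enum-length≡2-other (proj₂ (children v)) (children-length o)

  other-parent : ∀ {u v} → indeg G v ≡ 2 → Edge G u v → ∃ λ u′ → Edge G u′ v × u′ ≢ u
  other-parent {v = v} i = enum-length≡2-other (proj₂ (parents v)) (parents-length i)

  some-parent : ∀ {v n} → indeg G v ≡ suc n → ∃ λ u → Edge G u v
  some-parent {v} i = enum-length≡suc (proj₂ (parents v)) (parents-length i)

  2≤outdeg : ∀ {v w₁ w₂} → Edge G v w₁ → Edge G v w₂ → w₁ ≢ w₂ → 2 ≤ outdeg G v
  2≤outdeg {v} e₁ e₂ w₁≢w₂ = subst (2 ≤_) (sym (outdeg-enumerates (proj₂ (children v))))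
    (enum-2≤length (proj₂ (children v)) e₁ e₂ w₁≢w₂)

open Degrees public using (outdeg-enumerates; indeg-enumerates; children; parents)

_++ₚ_ : ∀ {G u v w} → Path G u v → Path G v w → Path G u w
arc e    ++ₚ q = e ∷ₚ q
(e ∷ₚ p) ++ₚ q = e ∷ₚ (p ++ₚ q)

module _ (Vs : List ℕ) (_⇝_ : ℕ → ℕ → Set) (⇝-trans : ∀ {x y z} → x ⇝ y → y ⇝ z → x ⇝ z)
         (W : ℕ → Set) (W⊆Vs : ∀ {v} → W v → v ∈ Vs) {F : Set}
         (step : ∀ v → W v → F ⊎ ∃ λ w → W w × v ⇝ w) where

  -- The visited vertices are distinct and lie in Vs, so the walk cannot run
  -- for more than |Vs| steps without revisiting a vertex and closing a cycle.
  private
    walk : (fuel v : ℕ) (visited : List ℕ) → W v → Unique visited → visited ⊆ Vs →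
           (∀ {x} → x ∈ visited → x ≡ v ⊎ x ⇝ v) → length Vs < length visited + fuel → F ⊎ ∃ λ x → x ⇝ x
    walk zero v visited _ u ⊆Vs _ lt =
      ⊥-elim (<-irrefl refl (≤-trans lt (subst (_≤ length Vs) (sym (+-identityʳ _)) (unique-length-≤ _≟_ u ⊆Vs))))
    walk (suc fuel) v visited Wv u ⊆Vs reach lt with step v Wv
    ... | inj₁ f = inj₁ f
    ... | inj₂ (w , Ww , v⇝w) with w ∈? visited
    ...   | yes w∈ with reach w∈
    ...     | inj₁ refl = inj₂ (w , v⇝w)
    ...     | inj₂ w⇝v  = inj₂ (w , ⇝-trans w⇝v v⇝w)
    walk (suc fuel) v visited Wv u ⊆Vs reach lt | inj₂ (w , Ww , v⇝w) | no w∉ =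
      walk fuel w (w ∷ visited) Ww (¬Any⇒All¬ _ w∉ ∷ u) ⊆Vs′ reach′ (subst (length Vs <_) (+-suc _ fuel) lt)
      where
      ⊆Vs′ : w ∷ visited ⊆ Vs
      ⊆Vs′ (here refl) = W⊆Vs Ww
      ⊆Vs′ (there x∈) = ⊆Vs x∈
      reach′ : ∀ {x} → x ∈ w ∷ visited → x ≡ w ⊎ x ⇝ w
      reach′ (here refl) = inj₁ refl
      reach′ (there x∈) with reach x∈
      ... | inj₁ refl = inj₂ v⇝w
      ... | inj₂ x⇝v  = inj₂ (⇝-trans x⇝v v⇝w)

  descent : ∀ {v} → W v → F ⊎ ∃ λ x → x ⇝ x
  descent Wv = walk (length Vs) _ (_ ∷ []) Wv ([] ∷ []) (λ { (here refl) → W⊆Vs Wv }) (λ { (here refl) → inj₁ refl }) (n<1+n _)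

data Kind (G : Graph) (v : ℕ) : Set where
  root         : indeg G v ≡ 0 → outdeg G v ≡ 2 → Kind G v
  isolated     : indeg G v ≡ 0 → outdeg G v ≡ 0 → Kind G v
  leaf         : indeg G v ≡ 1 → outdeg G v ≡ 0 → Kind G v
  tree         : indeg G v ≡ 1 → outdeg G v ≡ 2 → Kind G v
  reticulation : indeg G v ≡ 2 → outdeg G v ≡ 1 → Kind G v

TreeOrLeaf : Graph → ℕ → Set
TreeOrLeaf G v = IsTreeVertex G v ⊎ IsLeaf G v

module VertexClasses (G : Graph) {v : ℕ} where

  reticulation⇒¬leaf : IsReticulation G v → ¬ IsLeaf G v
  reticulation⇒¬leaf (_ , _ , o) (_ , _ , o′) with trans (sym o) o′
  ... | ()

  tree⇒¬leaf : IsTreeVertex G v → ¬ IsLeaf G v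
  tree⇒¬leaf (_ , _ , o) (_ , _ , o′) with trans (sym o) o′
  ... | ()

  tree⇒¬reticulation : IsTreeVertex G v → ¬ IsReticulation G v
  tree⇒¬reticulation (_ , _ , o) (_ , _ , o′) with trans (sym o) o′
  ... | ()

  treeOrLeaf⇒¬reticulation : TreeOrLeaf G v → ¬ IsReticulation G v
  treeOrLeaf⇒¬reticulation (inj₁ t) = tree⇒¬reticulation t
  treeOrLeaf⇒¬reticulation (inj₂ l) r = reticulation⇒¬leaf r l

module _ {G : Graph} where

  single-vertex-no-arc : ∀ {u w} → SingleVertex G → ¬ Edge G u w
  single-vertex-no-arc (_ , _ , A≡[]) e = case subst (_ ∈_) A≡[] e of λ ()

  single-vertex-outdeg : ∀ {v} → SingleVertex G → outdeg G v ≡ 0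
  single-vertex-outdeg {v} (_ , _ , A≡[]) = subst (λ as → length (filter (λ e → proj₁ e ≟ v) as) ≡ 0) (sym A≡[]) refl

  single-vertex-indeg : ∀ {v} → SingleVertex G → indeg G v ≡ 0
  single-vertex-indeg {v} (_ , _ , A≡[]) = subst (λ as → length (filter (λ e → proj₂ e ≟ v) as) ≡ 0) (sym A≡[]) refl

  single-vertex-unique : ∀ {x y} → SingleVertex G → x ∈ V G → y ∈ V G → x ≡ y
  single-vertex-unique (z , V≡[z] , _) x∈ y∈ = trans (the-one (subst (_ ∈_) V≡[z] x∈)) (sym (the-one (subst (_ ∈_) V≡[z] y∈)))
    where
    the-one : ∀ {x} → x ∈ z ∷ [] → x ≡ z
    the-one (here x≡z) = x≡z

module Network {G : Graph} (N : IsNetwork G) where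

  uniqueV : Unique (V G)
  uniqueV = proj₁ N
  uniqueA : Unique (A G)
  uniqueA = proj₁ (proj₂ N)
  acyclic : Acyclic G
  acyclic = proj₁ (proj₂ (proj₂ (proj₂ (proj₂ N))))
  shape : SingleVertex G ⊎ BinaryConditions G
  shape = proj₂ (proj₂ (proj₂ (proj₂ (proj₂ N))))
  open Degrees G uniqueA public
  open VertexClasses G public

  source∈V : ∀ {u v} → Edge G u v → u ∈ V G
  source∈V e = proj₁ (proj₁ (proj₂ (proj₂ N)) _ _ e)
  target∈V : ∀ {u v} → Edge G u v → v ∈ V G
  target∈V e = proj₂ (proj₁ (proj₂ (proj₂ N)) _ _ e)

  arc-≢ : ∀ {u v} → Edge G u v → u ≢ v
  arc-≢ = proj₁ (proj₂ (proj₂ (proj₂ N))) _ _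

  kind : ∀ {v} → v ∈ V G → Kind G v
  kind {v} v∈ with shape
  ... | inj₁ sv = isolated (single-vertex-indeg sv) (single-vertex-outdeg sv)
  ... | inj₂ (ρ , (_ , i , o) , rest) with v ≟ ρ
  ...   | yes refl = root i o
  ...   | no v≢ρ with rest v v∈ v≢ρ
  ...     | inj₁ (_ , i , o)        = leaf i o
  ...     | inj₂ (inj₁ (_ , i , o)) = tree i o
  ...     | inj₂ (inj₂ (_ , i , o)) = reticulation i o

  source-kind : ∀ {u v} → Edge G u v → Kind G u
  source-kind e = kind (source∈V e)
  target-kind : ∀ {u v} → Edge G u v → Kind G v
  target-kind e = kind (target∈V e)

  leaf-no-child : ∀ {a w} → IsLeaf G a → ¬ Edge G a w
  leaf-no-child (_ , _ , o) = no-child o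

  leaf-parent-unique : ∀ {a u u′} → IsLeaf G a → Edge G u a → Edge G u′ a → u ≡ u′
  leaf-parent-unique (_ , i , _) = unique-parent i

  distinct-children : ∀ {v w₁ w₂} → Edge G v w₁ → Edge G v w₂ → w₁ ≢ w₂ →
    outdeg G v ≡ 2 × (indeg G v ≡ 0 ⊎ indeg G v ≡ 1)
  distinct-children e₁ e₂ w₁≢w₂ with 2≤outdeg e₁ e₂ w₁≢w₂ | source-kind e₁
  ... | _  | root i o         = o , inj₁ i
  ... | _  | tree i o         = o , inj₂ i
  ... | le | isolated _ o     = ⊥-elim (case subst (2 ≤_) o le of λ ())
  ... | le | leaf _ o         = ⊥-elim (case subst (2 ≤_) o le of λ ())
  ... | le | reticulation _ o = ⊥-elim (case subst (2 ≤_) o le of λ { (s≤s ()) })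

  has-parent : ∀ {v} → indeg G v ≢ 0 → ∃ λ u → Edge G u v
  has-parent {v} i with indeg G v in eq
  ... | zero  = ⊥-elim (i refl)
  ... | suc _ = some-parent eq

  indeg≡0-unique : ∀ {u v} → u ∈ V G → v ∈ V G → indeg G u ≡ 0 → indeg G v ≡ 0 → u ≡ v
  indeg≡0-unique u∈ v∈ iu iv with shape
  ... | inj₁ sv = single-vertex-unique sv u∈ v∈
  ... | inj₂ (ρ , _ , rest) = trans (is-ρ u∈ iu) (sym (is-ρ v∈ iv))
    where
    is-ρ : ∀ {x} → x ∈ V G → indeg G x ≡ 0 → x ≡ ρ
    is-ρ {x} x∈ i with x ≟ ρ
    ... | yes x≡ρ = x≡ρ
    ... | no x≢ρ with rest x x∈ x≢ρ
    ...   | inj₁ (_ , i′ , _)        = case trans (sym i) i′ of λ ()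
    ...   | inj₂ (inj₁ (_ , i′ , _)) = case trans (sym i) i′ of λ ()
    ...   | inj₂ (inj₂ (_ , i′ , _)) = case trans (sym i) i′ of λ ()

-- Cherry reductions

outdeg-preserved : ∀ {G G′ v} → Unique (A G) → Unique (A G′) →
  (∀ {cs} → Children G v cs → ∃ λ cs′ → Children G′ v cs′ × length cs′ ≡ length cs) → outdeg G′ v ≡ outdeg G v
outdeg-preserved {G} {G′} {v} uA uA′ transport with children G uA v
... | cs , e with transport e
...   | cs′ , e′ , len = trans (outdeg-enumerates G′ uA′ e′) (trans len (sym (outdeg-enumerates G uA e)))

indeg-preserved : ∀ {G G′ v} → Unique (A G) → Unique (A G′) →
  (∀ {ps} → Parents G v ps → ∃ λ ps′ → Parents G′ v ps′ × length ps′ ≡ length ps) → indeg G′ v ≡ indeg G v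
indeg-preserved {G} {G′} {v} uA uA′ transport with parents G uA v
... | ps , e with transport e
...   | ps′ , e′ , len = trans (indeg-enumerates G′ uA′ e′) (trans len (sym (indeg-enumerates G uA e)))

OneOf : ℕ → ℕ → ℕ → Set
OneOf d₁ d₂ d = d ≡ d₁ ⊎ d ≡ d₂

-- A reduction that does not produce the single vertex: it deletes two vertices
-- del₁, del₂ and replaces each path u → del → w ending in a leaf w by an arc u → w.
record Bypass (r : CPair) (G G′ : Graph) : Set where
  field
    del₁ del₂ : ℕ
    V′⇒V        : ∀ {x} → x ∈ V G′ → x ∈ V G × x ≢ del₁ × x ≢ del₂
    V⇒V′        : ∀ {x} → x ∈ V G → x ≢ del₁ → x ≢ del₂ → x ∈ V G′
    keeps-arc   : ∀ {u w} → Edge G u w → u ∈ V G′ → w ∈ V G′ → Edge G′ u w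
    arcsInV′    : ∀ {u w} → Edge G′ u w → u ∈ V G′ × w ∈ V G′
    arc-origin  : ∀ {u w} → Edge G′ u w →
                  Edge G u w ⊎ ∃ λ m → Edge G u m × Edge G m w × OneOf del₁ del₂ m × IsLeaf G w
    outdeg-kept : ∀ {v} → v ∈ V G′ → outdeg G′ v ≡ outdeg G v
    indeg-kept  : ∀ {v} → v ∈ V G′ → indeg G′ v ≡ indeg G v
    deleted-has-parent   : ∀ {d} → OneOf del₁ del₂ d → indeg G d ≢ 0
    deleted-leaf∈r       : ∀ {w} → IsLeaf G w → OneOf del₁ del₂ w → Contains r w
    deleted-leaf-child∈r : ∀ {d w} → OneOf del₁ del₂ d → Edge G d w → IsLeaf G w → Contains r w
    deleted-leaf-child   : ∀ {d} → OneOf del₁ del₂ d → outdeg G d ≢ 0 → ∃ λ w → Edge G d w × IsLeaf G w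
    deleted-kind         : ∀ {d} → OneOf del₁ del₂ d → TreeOrLeaf G d ⊎
                           (IsReticulation G d × ∀ {d′} → OneOf del₁ del₂ d′ → IsReticulation G d′ → d′ ≡ d)
    bypass : ∀ {u z} → u ∈ V G′ → Edge G u z → OneOf del₁ del₂ z →
             ∃ λ z′ → Edge G′ u z′ × IsLeaf G z′ × Contains r z′ × (IsTreeVertex G z ⊎ ∃ λ w → r ≡ ret z′ w)

  deleted? : ∀ x → OneOf del₁ del₂ x ⊎ (x ≢ del₁ × x ≢ del₂)
  deleted? x with x ≟ del₁ | x ≟ del₂
  ... | yes x≡d₁ | _        = inj₁ (inj₁ x≡d₁)
  ... | no _     | yes x≡d₂ = inj₁ (inj₂ x≡d₂)
  ... | no x≢d₁  | no x≢d₂  = inj₂ (x≢d₁ , x≢d₂)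

  transfer : ∀ {w i o} → w ∈ V G′ → w ∈ V G × indeg G w ≡ i × outdeg G w ≡ o →
             w ∈ V G′ × indeg G′ w ≡ i × outdeg G′ w ≡ o
  transfer w∈′ (_ , i , o) = w∈′ , trans (indeg-kept w∈′) i , trans (outdeg-kept w∈′) o

  transfer⁻ : ∀ {w i o} → w ∈ V G′ × indeg G′ w ≡ i × outdeg G′ w ≡ o →
              w ∈ V G × indeg G w ≡ i × outdeg G w ≡ o
  transfer⁻ (w∈′ , i , o) = proj₁ (V′⇒V w∈′) , trans (sym (indeg-kept w∈′)) i , trans (sym (outdeg-kept w∈′)) o

  treeOrLeaf′ : ∀ {w} → w ∈ V G′ → TreeOrLeaf G w → TreeOrLeaf G′ w
  treeOrLeaf′ w∈′ (inj₁ t) = inj₁ (transfer w∈′ t)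
  treeOrLeaf′ w∈′ (inj₂ l) = inj₂ (transfer w∈′ l)

  treeOrLeaf⁻ : ∀ {w} → TreeOrLeaf G′ w → TreeOrLeaf G w
  treeOrLeaf⁻ (inj₁ t) = inj₁ (transfer⁻ t)
  treeOrLeaf⁻ (inj₂ l) = inj₂ (transfer⁻ l)

  leaf-survives : ∀ {c} → IsLeaf G c → ¬ Contains r c → c ∈ V G′
  leaf-survives l c∉r = V⇒V′ (proj₁ l) (λ c≡ → c∉r (deleted-leaf∈r l (inj₁ c≡))) (λ c≡ → c∉r (deleted-leaf∈r l (inj₂ c≡)))

  parent-survives : IsNetwork G → ∀ {c u} → IsLeaf G c → ¬ Contains r c → Edge G u c → u ∈ V G′ × Edge G′ u c
  parent-survives N {u = u} l c∉r e = u∈′ , keeps-arc e u∈′ (leaf-survives l c∉r)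
    where
    u∈′ : u ∈ V G′
    u∈′ = V⇒V′ (Network.source∈V N e) (λ u≡ → c∉r (deleted-leaf-child∈r (inj₁ u≡) e l))
                                       (λ u≡ → c∉r (deleted-leaf-child∈r (inj₂ u≡) e l))

  arc′⇒path : ∀ {u w} → Edge G′ u w → Path G u w
  arc′⇒path e′ with arc-origin e′
  ... | inj₁ e = arc e
  ... | inj₂ (_ , u→m , m→w , _) = u→m ∷ₚ arc m→w

  path′⇒path : ∀ {u w} → Path G′ u w → Path G u w
  path′⇒path (arc e′) = arc′⇒path e′
  path′⇒path (e′ ∷ₚ p′) = arc′⇒path e′ ++ₚ path′⇒path p′

module CherryBypass {G G′ : Graph} (N : IsNetwork G) {a b p g : ℕ}
  (a≢b : a ≢ b) (la : IsLeaf G a) (lb : IsLeaf G b) (uniqueA′ : Unique (A G′))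
  (p→a : Edge G p a) (p→b : Edge G p b) (g→p : Edge G g p)
  (V′⇔ : ∀ x → (x ∈ V G′) ⇔ ((x ∈ V G) × (x ≢ a) × (x ≢ p)))
  (A′⇔ : ∀ e → (e ∈ A G′) ⇔ (((e ∈ A G) × NotIncident a p e) ⊎ (e ≡ (g , b)))) where
  open Network N

  parent-a : ∀ {u} → Edge G u a → u ≡ p
  parent-a e = leaf-parent-unique la e p→a
  parent-b : ∀ {u} → Edge G u b → u ≡ p
  parent-b e = leaf-parent-unique lb e p→b

  p-kind : outdeg G p ≡ 2 × (indeg G p ≡ 0 ⊎ indeg G p ≡ 1)
  p-kind = distinct-children p→a p→b a≢b
  p-tree : IsTreeVertex G p
  p-tree with p-kind
  ... | o , inj₁ i = ⊥-elim (no-parent i g→p)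
  ... | o , inj₂ i = source∈V p→a , i , o
  parent-p : ∀ {u} → Edge G u p → u ≡ g
  parent-p e = unique-parent (proj₁ (proj₂ p-tree)) e g→p
  child-p : ∀ {w} → Edge G p w → w ≡ a ⊎ w ≡ b
  child-p = only-children (proj₁ p-kind) p→a p→b a≢b

  g→b′ : Edge G′ g b
  g→b′ = from (A′⇔ _) (inj₂ refl)
  kept-arc : ∀ {u w} → Edge G u w → u ≢ a → w ≢ a → u ≢ p → w ≢ p → Edge G′ u w
  kept-arc e u≢a w≢a u≢p w≢p = from (A′⇔ _) (inj₁ (e , u≢a , w≢a , u≢p , w≢p))
  arc′-cases : ∀ {u w} → Edge G′ u w → (Edge G u w × u ≢ a × w ≢ a × u ≢ p × w ≢ p) ⊎ (u ≡ g × w ≡ b)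
  arc′-cases e′ with to (A′⇔ _) e′
  ... | inj₁ kept = inj₁ kept
  ... | inj₂ uw≡gb = inj₂ (,-injective uw≡gb)

  children′ : ∀ {v w} → v ∈ V G′ → Edge G′ v w ⇔ ((Edge G v w × w ≢ p) ⊎ (Edge G v p × w ≡ b))
  children′ {v} v∈′ = mk⇔ forth back
    where
    v≢a : v ≢ a
    v≢a = proj₁ (proj₂ (to (V′⇔ v) v∈′))
    v≢p : v ≢ p
    v≢p = proj₂ (proj₂ (to (V′⇔ v) v∈′))
    forth : ∀ {w} → Edge G′ v w → (Edge G v w × w ≢ p) ⊎ (Edge G v p × w ≡ b)
    forth e′ with arc′-cases e′
    ... | inj₁ (e , _ , _ , _ , w≢p) = inj₁ (e , w≢p)
    ... | inj₂ (refl , refl)          = inj₂ (g→p , refl)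
    back : ∀ {w} → (Edge G v w × w ≢ p) ⊎ (Edge G v p × w ≡ b) → Edge G′ v w
    back (inj₁ (e , w≢p)) = kept-arc e v≢a (λ { refl → v≢p (parent-a e) }) v≢p w≢p
    back (inj₂ (e , refl)) = subst (λ u → Edge G′ u b) (sym (parent-p e)) g→b′

  parents′ : ∀ {u v} → v ∈ V G′ → Edge G′ u v ⇔ ((Edge G u v × u ≢ p) ⊎ (Edge G p v × u ≡ g))
  parents′ {v = v} v∈′ = mk⇔ forth back
    where
    v≢a : v ≢ a
    v≢a = proj₁ (proj₂ (to (V′⇔ v) v∈′))
    v≢p : v ≢ p
    v≢p = proj₂ (proj₂ (to (V′⇔ v) v∈′))
    forth : ∀ {u} → Edge G′ u v → (Edge G u v × u ≢ p) ⊎ (Edge G p v × u ≡ g)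
    forth e′ with arc′-cases e′
    ... | inj₁ (e , _ , _ , u≢p , _) = inj₁ (e , u≢p)
    ... | inj₂ (refl , refl)          = inj₂ (p→b , refl)
    back : ∀ {u} → (Edge G u v × u ≢ p) ⊎ (Edge G p v × u ≡ g) → Edge G′ u v
    back (inj₁ (e , u≢p)) = kept-arc e (λ { refl → leaf-no-child la e }) v≢a u≢p v≢p
    back (inj₂ (e , refl)) with child-p e
    ... | inj₁ v≡a = ⊥-elim (v≢a v≡a)
    ... | inj₂ refl = g→b′

  g-not-parent-of-p's-children : ∀ {v} → Edge G p v → ¬ Edge G g v
  g-not-parent-of-p's-children p→v g→v with child-p p→v
  ... | inj₁ refl = arc-≢ g→p (parent-a g→v)
  ... | inj₂ refl = arc-≢ g→p (parent-b g→v)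

  bypass : Bypass (cherry a b) G G′
  bypass = record
    { del₁ = a ; del₂ = p
    ; V′⇒V = λ x∈′ → to (V′⇔ _) x∈′
    ; V⇒V′ = λ x∈ x≢a x≢p → from (V′⇔ _) (x∈ , x≢a , x≢p)
    ; keeps-arc = λ e u∈′ w∈′ → kept-arc e (proj₁ (proj₂ (to (V′⇔ _) u∈′))) (proj₁ (proj₂ (to (V′⇔ _) w∈′)))
                                             (proj₂ (proj₂ (to (V′⇔ _) u∈′))) (proj₂ (proj₂ (to (V′⇔ _) w∈′)))
    ; arcsInV′ = arcsInV′
    ; arc-origin = arc-origin
    ; outdeg-kept = λ v∈′ → outdeg-preserved {G} {G′} uniqueA uniqueA′
        (λ e → enum-replace e (λ v→p v→b → arc-≢ v→p (parent-b v→b)) (children′ v∈′))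
    ; indeg-kept = λ v∈′ → indeg-preserved {G} {G′} uniqueA uniqueA′
        (λ e → enum-replace e g-not-parent-of-p's-children (parents′ v∈′))
    ; deleted-has-parent = λ { (inj₁ refl) i → no-parent i p→a ; (inj₂ refl) i → no-parent i g→p }
    ; deleted-leaf∈r = λ { _ (inj₁ refl) → inj₁ refl ; l (inj₂ refl) → ⊥-elim (tree⇒¬leaf p-tree l) }
    ; deleted-leaf-child∈r = λ { (inj₁ refl) e _ → ⊥-elim (leaf-no-child la e) ; (inj₂ refl) e _ → child-p e }
    ; deleted-leaf-child = λ { (inj₁ refl) o → ⊥-elim (o (proj₂ (proj₂ la))) ; (inj₂ refl) _ → a , p→a , la }
    ; deleted-kind = λ { (inj₁ refl) → inj₁ (inj₂ la) ; (inj₂ refl) → inj₁ (inj₁ p-tree) }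
    ; bypass = bypass′
    }
    where
    V⇒V′ : ∀ {x} → x ∈ V G → x ≢ a → x ≢ p → x ∈ V G′
    V⇒V′ x∈ x≢a x≢p = from (V′⇔ _) (x∈ , x≢a , x≢p)
    arcsInV′ : ∀ {u w} → Edge G′ u w → u ∈ V G′ × w ∈ V G′
    arcsInV′ e′ with arc′-cases e′
    ... | inj₁ (e , u≢a , w≢a , u≢p , w≢p) = V⇒V′ (source∈V e) u≢a u≢p , V⇒V′ (target∈V e) w≢a w≢p
    ... | inj₂ (refl , refl) = V⇒V′ (source∈V g→p) (λ { refl → leaf-no-child la g→p }) (arc-≢ g→p)
                             , V⇒V′ (proj₁ lb) (λ b≡a → a≢b (sym b≡a)) (λ b≡p → arc-≢ p→b (sym b≡p))
    arc-origin : ∀ {u w} → Edge G′ u w → Edge G u w ⊎ ∃ λ m → Edge G u m × Edge G m w × OneOf a p m × IsLeaf G w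
    arc-origin e′ with arc′-cases e′
    ... | inj₁ (e , _) = inj₁ e
    ... | inj₂ (refl , refl) = inj₂ (p , g→p , p→b , inj₂ refl , lb)
    bypass′ : ∀ {u z} → u ∈ V G′ → Edge G u z → OneOf a p z →
      ∃ λ z′ → Edge G′ u z′ × IsLeaf G z′ × Contains (cherry a b) z′ × (IsTreeVertex G z ⊎ ∃ λ w → cherry a b ≡ ret z′ w)
    bypass′ u∈′ e (inj₁ refl) = ⊥-elim (proj₂ (proj₂ (to (V′⇔ _) u∈′)) (parent-a e))
    bypass′ u∈′ e (inj₂ refl) with parent-p e
    ... | refl = b , g→b′ , lb , inj₂ refl , inj₁ p-tree

module RetBypass {G G′ : Graph} (N : IsNetwork G) {a b pa pb q g : ℕ}
  (a≢b : a ≢ b) (la : IsLeaf G a) (lb : IsLeaf G b) (uniqueA′ : Unique (A G′))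
  (pa→a : Edge G pa a) (pb→b : Edge G pb b) (pa-ret : IsReticulation G pa) (pb→pa : Edge G pb pa)
  (q→pa : Edge G q pa) (q≢pb : q ≢ pb) (g→pb : Edge G g pb)
  (V′⇔ : ∀ x → (x ∈ V G′) ⇔ ((x ∈ V G) × (x ≢ pa) × (x ≢ pb)))
  (A′⇔ : ∀ e → (e ∈ A G′) ⇔ (((e ∈ A G) × NotIncident pa pb e) ⊎ (e ≡ (g , b)) ⊎ (e ≡ (q , a)))) where
  open Network N

  parent-a : ∀ {u} → Edge G u a → u ≡ pa
  parent-a e = leaf-parent-unique la e pa→a
  parent-b : ∀ {u} → Edge G u b → u ≡ pb
  parent-b e = leaf-parent-unique lb e pb→b
  parents-pa : ∀ {u} → Edge G u pa → u ≡ pb ⊎ u ≡ q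
  parents-pa = only-parents (proj₁ (proj₂ pa-ret)) pb→pa q→pa (λ pb≡q → q≢pb (sym pb≡q))
  child-pa : ∀ {w} → Edge G pa w → w ≡ a
  child-pa e = unique-child (proj₂ (proj₂ pa-ret)) e pa→a

  b≢pa : b ≢ pa
  b≢pa refl = reticulation⇒¬leaf pa-ret lb
  pb-kind : outdeg G pb ≡ 2 × (indeg G pb ≡ 0 ⊎ indeg G pb ≡ 1)
  pb-kind = distinct-children pb→b pb→pa b≢pa
  pb-tree : IsTreeVertex G pb
  pb-tree with pb-kind
  ... | o , inj₁ i = ⊥-elim (no-parent i g→pb)
  ... | o , inj₂ i = source∈V pb→b , i , o
  parent-pb : ∀ {u} → Edge G u pb → u ≡ g
  parent-pb e = unique-parent (proj₁ (proj₂ pb-tree)) e g→pb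
  children-pb : ∀ {w} → Edge G pb w → w ≡ b ⊎ w ≡ pa
  children-pb = only-children (proj₁ pb-kind) pb→b pb→pa b≢pa

  pa≢pb : pa ≢ pb
  pa≢pb pa≡pb = arc-≢ pb→pa (sym pa≡pb)
  g≢pa : g ≢ pa
  g≢pa refl = leaf-no-child la (subst (λ x → Edge G x b) (child-pa g→pb) pb→b)

  g→b′ : Edge G′ g b
  g→b′ = from (A′⇔ _) (inj₂ (inj₁ refl))
  q→a′ : Edge G′ q a
  q→a′ = from (A′⇔ _) (inj₂ (inj₂ refl))
  kept-arc : ∀ {u w} → Edge G u w → u ≢ pa → w ≢ pa → u ≢ pb → w ≢ pb → Edge G′ u w
  kept-arc e u≢pa w≢pa u≢pb w≢pb = from (A′⇔ _) (inj₁ (e , u≢pa , w≢pa , u≢pb , w≢pb))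
  arc′-cases : ∀ {u w} → Edge G′ u w →
    (Edge G u w × u ≢ pa × w ≢ pa × u ≢ pb × w ≢ pb) ⊎ (u ≡ g × w ≡ b) ⊎ (u ≡ q × w ≡ a)
  arc′-cases e′ with to (A′⇔ _) e′
  ... | inj₁ kept = inj₁ kept
  ... | inj₂ (inj₁ uw≡gb) = inj₂ (inj₁ (,-injective uw≡gb))
  ... | inj₂ (inj₂ uw≡qa) = inj₂ (inj₂ (,-injective uw≡qa))

  -- Children (parents) of a surviving vertex in G′ arise from those in G by
  -- first replacing pb by b (by g) and then pa by a (by q).
  Child₁ Parent₁ : ℕ → ℕ → Set
  Child₁ v x = (Edge G v x × x ≢ pb) ⊎ (Edge G v pb × x ≡ b)
  Parent₁ v x = (Edge G x v × x ≢ pb) ⊎ (Edge G pb v × x ≡ g)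

  children′ : ∀ {v w} → v ∈ V G′ → Edge G′ v w ⇔ ((Child₁ v w × w ≢ pa) ⊎ (Child₁ v pa × w ≡ a))
  children′ {v} v∈′ = mk⇔ forth back
    where
    v≢pa : v ≢ pa
    v≢pa = proj₁ (proj₂ (to (V′⇔ v) v∈′))
    v≢pb : v ≢ pb
    v≢pb = proj₂ (proj₂ (to (V′⇔ v) v∈′))
    forth : ∀ {w} → Edge G′ v w → (Child₁ v w × w ≢ pa) ⊎ (Child₁ v pa × w ≡ a)
    forth e′ with arc′-cases e′
    ... | inj₁ (e , _ , w≢pa , _ , w≢pb) = inj₁ (inj₁ (e , w≢pb) , w≢pa)
    ... | inj₂ (inj₁ (refl , refl))       = inj₁ (inj₂ (g→pb , refl) , b≢pa)
    ... | inj₂ (inj₂ (refl , refl))       = inj₂ (inj₁ (q→pa , pa≢pb) , refl)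
    back : ∀ {w} → (Child₁ v w × w ≢ pa) ⊎ (Child₁ v pa × w ≡ a) → Edge G′ v w
    back (inj₁ (inj₁ (e , w≢pb) , w≢pa)) = kept-arc e v≢pa w≢pa v≢pb w≢pb
    back (inj₁ (inj₂ (v→pb , refl) , _)) = subst (λ u → Edge G′ u b) (sym (parent-pb v→pb)) g→b′
    back (inj₂ (inj₁ (v→pa , _) , refl)) with parents-pa v→pa
    ... | inj₁ v≡pb = ⊥-elim (v≢pb v≡pb)
    ... | inj₂ refl = q→a′
    back (inj₂ (inj₂ (_ , pa≡b) , refl)) = ⊥-elim (b≢pa (sym pa≡b))

  parents′ : ∀ {u v} → v ∈ V G′ → Edge G′ u v ⇔ ((Parent₁ v u × u ≢ pa) ⊎ (Parent₁ v pa × u ≡ q))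
  parents′ {v = v} v∈′ = mk⇔ forth back
    where
    v≢pa : v ≢ pa
    v≢pa = proj₁ (proj₂ (to (V′⇔ v) v∈′))
    v≢pb : v ≢ pb
    v≢pb = proj₂ (proj₂ (to (V′⇔ v) v∈′))
    forth : ∀ {u} → Edge G′ u v → (Parent₁ v u × u ≢ pa) ⊎ (Parent₁ v pa × u ≡ q)
    forth e′ with arc′-cases e′
    ... | inj₁ (e , u≢pa , _ , u≢pb , _) = inj₁ (inj₁ (e , u≢pb) , u≢pa)
    ... | inj₂ (inj₁ (refl , refl))       = inj₁ (inj₂ (pb→b , refl) , g≢pa)
    ... | inj₂ (inj₂ (refl , refl))       = inj₂ (inj₁ (pa→a , pa≢pb) , refl)
    back : ∀ {u} → (Parent₁ v u × u ≢ pa) ⊎ (Parent₁ v pa × u ≡ q) → Edge G′ u v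
    back (inj₁ (inj₁ (e , u≢pb) , u≢pa)) = kept-arc e u≢pa v≢pa u≢pb v≢pb
    back (inj₁ (inj₂ (pb→v , refl) , _)) with children-pb pb→v
    ... | inj₁ refl = g→b′
    ... | inj₂ v≡pa = ⊥-elim (v≢pa v≡pa)
    back (inj₂ (inj₁ (pa→v , _) , refl)) with child-pa pa→v
    ... | refl = q→a′
    back (inj₂ (inj₂ (_ , pa≡g) , refl)) = ⊥-elim (g≢pa (sym pa≡g))

  private
    compose : ∀ {Q R : ℕ → Set} {xs : List ℕ} → (∃ λ ys → Enumerates Q ys × length ys ≡ length xs) →
      (∀ {ys} → Enumerates Q ys → ∃ λ zs → Enumerates R zs × length zs ≡ length ys) →
      ∃ λ zs → Enumerates R zs × length zs ≡ length xs
    compose (ys , e , len) next with next e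
    ... | zs , e′ , len′ = zs , e′ , trans len′ len

    child₁-unique : ∀ {v} → Child₁ v pa → ¬ Child₁ v a
    child₁-unique _ (inj₂ (_ , a≡b)) = a≢b a≡b
    child₁-unique (inj₂ (_ , pa≡b)) _ = b≢pa (sym pa≡b)
    child₁-unique (inj₁ (v→pa , _)) (inj₁ (v→a , _)) = arc-≢ v→pa (parent-a v→a)

    parent₁-unique : ∀ {v} → Parent₁ v pa → ¬ Parent₁ v q
    parent₁-unique (inj₂ (_ , pa≡g)) _ = g≢pa (sym pa≡g)
    parent₁-unique (inj₁ (pa→v , _)) (inj₁ (q→v , _)) with child-pa pa→v
    ... | refl = arc-≢ q→pa (parent-a q→v)
    parent₁-unique (inj₁ (pa→v , _)) (inj₂ (pb→v , _)) with child-pa pa→v | children-pb pb→v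
    ... | refl | inj₁ a≡b  = a≢b a≡b
    ... | refl | inj₂ a≡pa = arc-≢ pa→a (sym a≡pa)

    g-not-parent-of-pb's-children : ∀ {v} → v ≢ pa → Edge G pb v → ¬ Edge G g v
    g-not-parent-of-pb's-children v≢pa pb→v g→v with children-pb pb→v
    ... | inj₁ refl = arc-≢ g→pb (parent-b g→v)
    ... | inj₂ v≡pa = v≢pa v≡pa

  bypass : Bypass (ret a b) G G′
  bypass = record
    { del₁ = pa ; del₂ = pb
    ; V′⇒V = λ x∈′ → to (V′⇔ _) x∈′
    ; V⇒V′ = V⇒V′
    ; keeps-arc = λ e u∈′ w∈′ → kept-arc e (proj₁ (proj₂ (to (V′⇔ _) u∈′))) (proj₁ (proj₂ (to (V′⇔ _) w∈′)))
                                             (proj₂ (proj₂ (to (V′⇔ _) u∈′))) (proj₂ (proj₂ (to (V′⇔ _) w∈′)))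
    ; arcsInV′ = arcsInV′
    ; arc-origin = arc-origin
    ; outdeg-kept = λ v∈′ → outdeg-preserved {G} {G′} uniqueA uniqueA′ λ {cs} e →
        compose {xs = cs} (enum-replace e (λ v→pb v→b → arc-≢ v→pb (parent-b v→b)) (⇔-id _))
                (λ e₁ → enum-replace e₁ child₁-unique (children′ v∈′))
    ; indeg-kept = λ v∈′ → indeg-preserved {G} {G′} uniqueA uniqueA′ λ {ps} e →
        compose {xs = ps} (enum-replace e (g-not-parent-of-pb's-children (proj₁ (proj₂ (to (V′⇔ _) v∈′)))) (⇔-id _))
                (λ e₁ → enum-replace e₁ parent₁-unique (parents′ v∈′))
    ; deleted-has-parent = λ { (inj₁ refl) i → no-parent i pb→pa ; (inj₂ refl) i → no-parent i g→pb }
    ; deleted-leaf∈r = λ { l (inj₁ refl) → ⊥-elim (reticulation⇒¬leaf pa-ret l)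
                         ; l (inj₂ refl) → ⊥-elim (tree⇒¬leaf pb-tree l) }
    ; deleted-leaf-child∈r = deleted-leaf-child∈r
    ; deleted-leaf-child = λ { (inj₁ refl) _ → a , pa→a , la ; (inj₂ refl) _ → b , pb→b , lb }
    ; deleted-kind = λ { (inj₂ refl) → inj₁ (inj₁ pb-tree)
                       ; (inj₁ refl) → inj₂ (pa-ret , λ { (inj₁ d≡pa) _ → d≡pa
                                                        ; (inj₂ refl) r → ⊥-elim (tree⇒¬reticulation pb-tree r) }) }
    ; bypass = bypass′
    }
    where
    V⇒V′ : ∀ {x} → x ∈ V G → x ≢ pa → x ≢ pb → x ∈ V G′
    V⇒V′ x∈ x≢pa x≢pb = from (V′⇔ _) (x∈ , x≢pa , x≢pb)
    arcsInV′ : ∀ {u w} → Edge G′ u w → u ∈ V G′ × w ∈ V G′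
    arcsInV′ e′ with arc′-cases e′
    ... | inj₁ (e , u≢pa , w≢pa , u≢pb , w≢pb) = V⇒V′ (source∈V e) u≢pa u≢pb , V⇒V′ (target∈V e) w≢pa w≢pb
    ... | inj₂ (inj₁ (refl , refl)) = V⇒V′ (source∈V g→pb) g≢pa (arc-≢ g→pb)
                                    , V⇒V′ (proj₁ lb) b≢pa (λ b≡pb → arc-≢ pb→b (sym b≡pb))
    ... | inj₂ (inj₂ (refl , refl)) = V⇒V′ (source∈V q→pa) (arc-≢ q→pa) q≢pb
                                    , V⇒V′ (proj₁ la) (λ a≡pa → arc-≢ pa→a (sym a≡pa)) (λ { refl → tree⇒¬leaf pb-tree la })
    arc-origin : ∀ {u w} → Edge G′ u w → Edge G u w ⊎ ∃ λ m → Edge G u m × Edge G m w × OneOf pa pb m × IsLeaf G w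
    arc-origin e′ with arc′-cases e′
    ... | inj₁ (e , _) = inj₁ e
    ... | inj₂ (inj₁ (refl , refl)) = inj₂ (pb , g→pb , pb→b , inj₂ refl , lb)
    ... | inj₂ (inj₂ (refl , refl)) = inj₂ (pa , q→pa , pa→a , inj₁ refl , la)
    deleted-leaf-child∈r : ∀ {d w} → OneOf pa pb d → Edge G d w → IsLeaf G w → Contains (ret a b) w
    deleted-leaf-child∈r (inj₁ refl) e _ = inj₁ (child-pa e)
    deleted-leaf-child∈r (inj₂ refl) e l with children-pb e
    ... | inj₁ w≡b = inj₂ w≡b
    ... | inj₂ refl = ⊥-elim (reticulation⇒¬leaf pa-ret l)
    bypass′ : ∀ {u z} → u ∈ V G′ → Edge G u z → OneOf pa pb z →
      ∃ λ z′ → Edge G′ u z′ × IsLeaf G z′ × Contains (ret a b) z′ × (IsTreeVertex G z ⊎ ∃ λ w → ret a b ≡ ret z′ w)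
    bypass′ u∈′ e (inj₁ refl) with parents-pa e
    ... | inj₁ u≡pb = ⊥-elim (proj₂ (proj₂ (to (V′⇔ _) u∈′)) u≡pb)
    ... | inj₂ refl = a , q→a′ , la , inj₁ refl , inj₂ (b , refl)
    bypass′ u∈′ e (inj₂ refl) with parent-pb e
    ... | refl = b , g→b′ , lb , inj₂ refl , inj₁ pb-tree

-- Reducing a cherry whose common parent is the root ends the sequence.
record FinalCherry (r : CPair) (G G′ : Graph) : Set where
  field
    a b p    : ℕ
    r≡       : r ≡ cherry a b
    p→a      : Edge G p a
    la       : IsLeaf G a
    lb       : IsLeaf G b
    vertices : ∀ {v} → v ∈ V G → v ≡ a ⊎ v ≡ p ⊎ v ≡ b
    single   : SingleVertex G′

module FinalCherryReduction {G G′ : Graph} (N : IsNetwork G) {a b p : ℕ}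
  (a≢b : a ≢ b) (la : IsLeaf G a) (lb : IsLeaf G b) (uniqueV′ : Unique (V G′))
  (p→a : Edge G p a) (p→b : Edge G p b) (p-parentless : indeg G p ≡ 0)
  (V′⇔ : ∀ x → (x ∈ V G′) ⇔ ((x ∈ V G) × (x ≢ a) × (x ≢ p)))
  (A′⇔ : ∀ e → (e ∈ A G′) ⇔ ((e ∈ A G) × NotIncident a p e)) where
  open Network N

  Other : ℕ → Set
  Other w = w ∈ V G × w ≢ a × w ≢ p × w ≢ b

  -- Every vertex other than p has a parent, and the parent of a vertex outside
  -- the cherry is again outside it; ascending forever would close a cycle.
  ascend : ∀ w → Other w → ⊥ ⊎ ∃ λ u → Other u × Path G u w
  ascend w (w∈ , w≢a , w≢p , w≢b) with has-parent (λ i → w≢p (indeg≡0-unique w∈ (source∈V p→a) i p-parentless))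
  ... | u , u→w = inj₂ (u , (source∈V u→w , (λ { refl → leaf-no-child la u→w }) , u≢p , (λ { refl → leaf-no-child lb u→w })) , arc u→w)
    where
    u≢p : u ≢ p
    u≢p refl with only-children (proj₁ (distinct-children p→a p→b a≢b)) p→a p→b a≢b u→w
    ... | inj₁ w≡a = w≢a w≡a
    ... | inj₂ w≡b = w≢b w≡b

  vertices : ∀ {v} → v ∈ V G → v ≡ a ⊎ v ≡ p ⊎ v ≡ b
  vertices {v} v∈ with v ≟ a | v ≟ p | v ≟ b
  ... | yes v≡a | _       | _       = inj₁ v≡a
  ... | no _    | yes v≡p | _       = inj₂ (inj₁ v≡p)
  ... | no _    | no _    | yes v≡b = inj₂ (inj₂ v≡b)
  ... | no v≢a  | no v≢p  | no v≢b
    with descent (V G) (λ x y → Path G y x) (λ p q → q ++ₚ p) Other proj₁ ascend (v∈ , v≢a , v≢p , v≢b)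
  ...   | inj₂ (x , cycle) = ⊥-elim (acyclic x cycle)

  single : SingleVertex G′
  single = b , unique-singleton uniqueV′ only-b (from (V′⇔ b) (proj₁ lb , (λ b≡a → a≢b (sym b≡a)) , λ b≡p → arc-≢ p→b (sym b≡p)))
             , no-arcs (λ {e} → no-arc e)
    where
    only-b : ∀ {x} → x ∈ V G′ → x ≡ b
    only-b x∈′ with to (V′⇔ _) x∈′
    ... | x∈ , x≢a , x≢p with vertices x∈
    ...   | inj₁ x≡a          = ⊥-elim (x≢a x≡a)
    ...   | inj₂ (inj₁ x≡p)   = ⊥-elim (x≢p x≡p)
    ...   | inj₂ (inj₂ x≡b)   = x≡b
    no-arc : ∀ e → ¬ e ∈ A G′
    no-arc (u , w) e∈′ with to (A′⇔ _) e∈′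
    ... | u→w , u≢a , _ , u≢p , _ with vertices (source∈V u→w)
    ...   | inj₁ u≡a        = u≢a u≡a
    ...   | inj₂ (inj₁ u≡p) = u≢p u≡p
    ...   | inj₂ (inj₂ refl) = leaf-no-child lb u→w
    no-arcs : ∀ {as : List Arc} → (∀ {e} → ¬ e ∈ as) → as ≡ []
    no-arcs {[]} _ = refl
    no-arcs {_ ∷ _} none = ⊥-elim (none (here refl))

  final : FinalCherry (cherry a b) G G′
  final = record { a = a ; b = b ; p = p ; r≡ = refl ; p→a = p→a ; la = la ; lb = lb ; vertices = vertices ; single = single }

reduction-view : ∀ {G G′ r} → IsNetwork G → Reduction G r G′ → Bypass r G G′ ⊎ FinalCherry r G G′
reduction-view {r = cherry a b} N (a≢b , la , lb , uV′ , _ , p , p→a , p→b , V′⇔ , inj₁ (p-parentless , A′⇔)) =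
  inj₂ (FinalCherryReduction.final N a≢b la lb uV′ p→a p→b p-parentless V′⇔ A′⇔)
reduction-view {r = cherry a b} N (a≢b , la , lb , _ , uA′ , p , p→a , p→b , V′⇔ , inj₂ (g , g→p , A′⇔)) =
  inj₁ (CherryBypass.bypass N a≢b la lb uA′ p→a p→b g→p V′⇔ A′⇔)
reduction-view {r = ret a b} N (a≢b , la , lb , _ , uA′ , pa , pb , q , g , pa→a , pb→b , pa-ret , pb→pa , q→pa , q≢pb , g→pb , V′⇔ , A′⇔) =
  inj₁ (RetBypass.bypass N a≢b la lb uA′ pa→a pb→b pa-ret pb→pa q→pa q≢pb g→pb V′⇔ A′⇔)

reduction-unique : ∀ {G G′ r} → Reduction G r G′ → Unique (V G′) × Unique (A G′)
reduction-unique {r = cherry _ _} (_ , _ , _ , uV′ , uA′ , _) = uV′ , uA′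
reduction-unique {r = ret _ _}    (_ , _ , _ , uV′ , uA′ , _) = uV′ , uA′

reduction-leaf : ∀ {G G′ r} → Reduction G r G′ → IsLeaf G (first r)
reduction-leaf {r = cherry _ _} (_ , la , _) = la
reduction-leaf {r = ret _ _}    (_ , la , _) = la

network-preserved : ∀ {G G′ r} → IsNetwork G → Reduction G r G′ → IsNetwork G′
network-preserved {G} {G′} N red with reduction-view N red
... | inj₂ fin = uV′ , uA′ , (λ _ _ e → ⊥-elim (single-vertex-no-arc single e)) , (λ _ _ e → ⊥-elim (single-vertex-no-arc single e))
               , (λ { _ (arc e) → single-vertex-no-arc single e ; _ (e ∷ₚ _) → single-vertex-no-arc single e }) , inj₁ single
  where
  open FinalCherry fin
  uV′ : Unique (V G′)
  uV′ = proj₁ (reduction-unique red)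
  uA′ : Unique (A G′)
  uA′ = proj₂ (reduction-unique red)
... | inj₁ byp = proj₁ (reduction-unique red) , proj₂ (reduction-unique red) , (λ _ _ → arcsInV′)
               , (λ { u _ e refl → acyclic u (arc′⇒path e) }) , (λ v p′ → acyclic v (path′⇒path p′)) , inj₂ binary
  where
  open Bypass byp
  open Network N
  binary : BinaryConditions G′
  binary with shape
  ... | inj₁ sv = case trans (sym (single-vertex-indeg sv)) (proj₁ (proj₂ (reduction-leaf red))) of λ ()
  ... | inj₂ (ρ , (ρ∈ , i , o) , rest) = ρ , transfer ρ∈′ (ρ∈ , i , o) , rest′
    where
    ρ∈′ : ρ ∈ V G′
    ρ∈′ = V⇒V′ ρ∈ (λ ρ≡ → deleted-has-parent (inj₁ ρ≡) i) (λ ρ≡ → deleted-has-parent (inj₂ ρ≡) i)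
    rest′ : ∀ v → v ∈ V G′ → v ≢ ρ → IsLeaf G′ v ⊎ IsTreeVertex G′ v ⊎ IsReticulation G′ v
    rest′ v v∈′ v≢ρ with rest v (proj₁ (V′⇒V v∈′)) v≢ρ
    ... | inj₁ l        = inj₁ (transfer v∈′ l)
    ... | inj₂ (inj₁ t) = inj₂ (inj₁ (transfer v∈′ t))
    ... | inj₂ (inj₂ t) = inj₂ (inj₂ (transfer v∈′ t))

treeChild-preserved : ∀ {G G′ r} → IsNetwork G → IsTreeChild G → Reduction G r G′ → IsTreeChild G′
treeChild-preserved {G′ = G′} N tc red with reduction-view N red
... | inj₂ fin = λ _ _ o → ⊥-elim (o (single-vertex-outdeg (FinalCherry.single fin)))
... | inj₁ byp = tc′
  where
  open Bypass byp
  open Network N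
  tc′ : IsTreeChild G′
  tc′ v v∈′ o′ with tc v (proj₁ (V′⇒V v∈′)) (λ o → o′ (trans (outdeg-kept v∈′) o))
  ... | u , v→u , tl with u ≟ del₁ | u ≟ del₂
  ... | no u≢d₁ | no u≢d₂ = u , keeps-arc v→u v∈′ u∈′ , treeOrLeaf′ u∈′ tl
    where
      u∈′ : u ∈ V G′
      u∈′ = V⇒V′ (target∈V v→u) u≢d₁ u≢d₂
  ... | yes u≡d₁ | _ = let z′ , v→z′ , lz , _ = bypass v∈′ v→u (inj₁ u≡d₁) in
                       z′ , v→z′ , inj₂ (transfer (proj₂ (arcsInV′ v→z′)) lz)
  ... | no _ | yes u≡d₂ = let z′ , v→z′ , lz , _ = bypass v∈′ v→u (inj₂ u≡d₂) in
                          z′ , v→z′ , inj₂ (transfer (proj₂ (arcsInV′ v→z′)) lz)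

-- Cherry-picking sequences

FirstOccurrence : ℕ → (S : List CPair) → Fin (length S) → Set
FirstOccurrence x S j = Contains (lookup S j) x × (∀ k → toℕ k < toℕ j → ¬ Contains (lookup S k) x)

-- The two ways in which a reticulated cherry (a , b) placed before S would
-- violate (P1) or (P2): the next pair containing a is itself reticulated, or
-- it is already the successor of an earlier reticulated pair of S.
Conflict : ℕ → List CPair → Set
Conflict a S = (∃ λ j → FirstOccurrence a S j × IsRetPair (lookup S j)) ⊎
               (∃ λ i → ∃ λ j → IsRetPair (lookup S i) × IsSucc S i j × FirstOccurrence a S j)

contains? : ∀ r x → Dec (Contains r x)
contains? (cherry a b) x = (x ≟ a) ⊎-dec (x ≟ b)
contains? (ret a b)    x = (x ≟ a) ⊎-dec (x ≟ b)

pair-kind : ∀ p → IsCherryPair p ⊎ IsRetPair p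
pair-kind (cherry x y) = inj₁ (x , y , refl)
pair-kind (ret x y)    = inj₂ (x , y , refl)

¬cherry∧ret : ∀ {r} → IsCherryPair r → ¬ IsRetPair r
¬cherry∧ret (_ , _ , refl) (_ , _ , ())

module _ {r : CPair} {S : List CPair} where

  first-here : ∀ {x} → Contains r x → FirstOccurrence x (r ∷ S) fzero
  first-here c = c , λ _ ()

  first-there : ∀ {x j} → ¬ Contains r x → FirstOccurrence x S j → FirstOccurrence x (r ∷ S) (fsuc j)
  first-there r∌x (c , earlier) = c , λ { fzero _ → r∌x ; (fsuc k) (s≤s k<j) → earlier k k<j }

  first-there⁻ : ∀ {x j} → FirstOccurrence x (r ∷ S) (fsuc j) → FirstOccurrence x S j × ¬ Contains r x
  first-there⁻ (c , earlier) = (c , λ k k<j → earlier (fsuc k) (s≤s k<j)) , earlier fzero (s≤s z≤n)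

  succ-head : ∀ {j} → FirstOccurrence (first r) S j → IsSucc (r ∷ S) fzero (fsuc j)
  succ-head (c , earlier) = s≤s z≤n , c , λ { fzero () ; (fsuc k) _ (s≤s k<j) → earlier k k<j }

  succ-head⁻ : ∀ {j} → IsSucc (r ∷ S) fzero (fsuc j) → FirstOccurrence (first r) S j
  succ-head⁻ (_ , c , between) = c , λ k k<j → between (fsuc k) (s≤s z≤n) (s≤s k<j)

  succ-tail : ∀ {i j} → IsSucc S i j → IsSucc (r ∷ S) (fsuc i) (fsuc j)
  succ-tail (i<j , c , between) = s≤s i<j , c , λ { fzero () ; (fsuc k) (s≤s i<k) (s≤s k<j) → between k i<k k<j }

  succ-tail⁻ : ∀ {i j} → IsSucc (r ∷ S) (fsuc i) (fsuc j) → IsSucc S i j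
  succ-tail⁻ (s≤s i<j , c , between) = i<j , c , λ k i<k k<j → between (fsuc k) (s≤s i<k) (s≤s k<j)

  ¬succ-zero : ∀ {i} → ¬ IsSucc (r ∷ S) i fzero
  ¬succ-zero (() , _)

  conflict-there : ∀ {a} → ¬ Contains r a → Conflict a S → Conflict a (r ∷ S)
  conflict-there r∌a (inj₁ (j , fo , ret-j)) = inj₁ (fsuc j , first-there r∌a fo , ret-j)
  conflict-there r∌a (inj₂ (i , j , ret-i , s , fo)) = inj₂ (fsuc i , fsuc j , ret-i , succ-tail s , first-there r∌a fo)

treeChildSeq-[] : TreeChildSeq []
treeChildSeq-[] = (λ ()) , (λ ())

treeChildSeq-tail : ∀ {r S} → TreeChildSeq (r ∷ S) → TreeChildSeq S
treeChildSeq-tail (p1 , p2) =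
  (λ i j ret-i s → p1 (fsuc i) (fsuc j) ret-i (succ-tail s)) ,
  (λ i i′ j i≢i′ ret-i ret-i′ s s′ → p2 (fsuc i) (fsuc i′) (fsuc j) (λ eq → i≢i′ (suc-injective eq)) ret-i ret-i′ (succ-tail s) (succ-tail s′))

treeChildSeq-head : ∀ {a b S} → TreeChildSeq (ret a b ∷ S) → ¬ Conflict a S
treeChildSeq-head (p1 , _) (inj₁ (j , fo , ret-j)) = ¬cherry∧ret (p1 fzero (fsuc j) (_ , _ , refl) (succ-head fo)) ret-j
treeChildSeq-head (_ , p2) (inj₂ (i , j , ret-i , s , fo)) = p2 fzero (fsuc i) (fsuc j) (λ ()) (_ , _ , refl) ret-i (succ-head fo) (succ-tail s)

treeChildSeq-∷ : ∀ {r S} → TreeChildSeq S → (∀ {a b} → r ≡ ret a b → ¬ Conflict a S) → TreeChildSeq (r ∷ S)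
treeChildSeq-∷ {r} {S} (p1 , p2) head-ok = q1 , q2
  where
  T : List CPair
  T = r ∷ S
  q1 : ∀ i j → IsRetPair (lookup T i) → IsSucc T i j → IsCherryPair (lookup T j)
  q1 i fzero _ s = ⊥-elim (¬succ-zero s)
  q1 (fsuc i) (fsuc j) ret-i s = p1 i j ret-i (succ-tail⁻ s)
  q1 fzero (fsuc j) (_ , _ , refl) s with pair-kind (lookup S j)
  ... | inj₁ cherry-j = cherry-j
  ... | inj₂ ret-j    = ⊥-elim (head-ok refl (inj₁ (j , succ-head⁻ s , ret-j)))
  q2 : ∀ i i′ j → i ≢ i′ → IsRetPair (lookup T i) → IsRetPair (lookup T i′) → IsSucc T i j → IsSucc T i′ j → ⊥
  q2 _ _ fzero _ _ _ s _ = ¬succ-zero s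
  q2 fzero fzero (fsuc _) i≢i′ _ _ _ _ = i≢i′ refl
  q2 fzero (fsuc i′) (fsuc j) _ (_ , _ , refl) ret-i′ s s′ = head-ok refl (inj₂ (i′ , j , ret-i′ , succ-tail⁻ s′ , succ-head⁻ s))
  q2 (fsuc i) fzero (fsuc j) _ ret-i (_ , _ , refl) s s′ = head-ok refl (inj₂ (i , j , ret-i , succ-tail⁻ s , succ-head⁻ s′))
  q2 (fsuc i) (fsuc i′) (fsuc j) i≢i′ ret-i ret-i′ s s′ =
    p2 i i′ j (λ eq → i≢i′ (cong fsuc eq)) ret-i ret-i′ (succ-tail⁻ s) (succ-tail⁻ s′)

-- First occurrences of leaves along a complete reduction

cherry-parent : ∀ {H H′ u v} → Reduction H (cherry u v) H′ →
  u ≢ v × IsLeaf H u × IsLeaf H v × ∃ λ p → Edge H p u × Edge H p v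
cherry-parent (u≢v , lu , lv , _ , _ , p , p→u , p→v , _) = u≢v , lu , lv , p , p→u , p→v

ret-shape : ∀ {H H′ u v} → Reduction H (ret u v) H′ → IsLeaf H u × IsLeaf H v ×
  ∃ λ pa → ∃ λ pb → ∃ λ q → Edge H pa u × Edge H pb v × IsReticulation H pa × Edge H pb pa × Edge H q pa × Edge H′ q u
ret-shape (_ , lu , lv , _ , _ , pa , pb , q , _ , pa→u , pb→v , pa-ret , pb→pa , q→pa , _ , _ , _ , A′⇔) =
  lu , lv , pa , pb , q , pa→u , pb→v , pa-ret , pb→pa , q→pa , from (A′⇔ _) (inj₂ (inj₂ refl))

final-leaf∈r : ∀ {H H′ r c} → IsNetwork H → FinalCherry r H H′ → IsLeaf H c → Contains r c
final-leaf∈r {c = c} N fin lc = subst (λ r → Contains r c) (sym r≡) cherry∋c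
  where
  open FinalCherry fin
  cherry∋c : Contains (cherry a b) c
  cherry∋c with vertices (proj₁ lc)
  ... | inj₁ c≡a         = inj₁ c≡a
  ... | inj₂ (inj₁ refl) = ⊥-elim (Network.leaf-no-child N lc p→a)
  ... | inj₂ (inj₂ c≡b)  = inj₂ c≡b

leaf-persists : ∀ {H H′ r c q} → IsNetwork H → Reduction H r H′ → IsLeaf H c → ¬ Contains r c → Edge H q c →
  Bypass r H H′ × IsLeaf H′ c × Edge H′ q c × q ∈ V H′
leaf-persists N red lc r∌c q→c with reduction-view N red
... | inj₂ fin = ⊥-elim (r∌c (final-leaf∈r N fin lc))
... | inj₁ byp with Bypass.parent-survives byp N lc r∌c q→c
...   | q∈′ , q→c′ = byp , Bypass.transfer byp (Bypass.leaf-survives byp lc r∌c) lc , q→c′ , q∈′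

distinct-parents⇒¬cherry : ∀ {H T a x qa qx} → IsNetwork H → CompleteReduction H T → IsLeaf H a → IsLeaf H x →
  Edge H qa a → Edge H qx x → qa ≢ qx → ∀ j → FirstOccurrence a T j → FirstOccurrence x T j → ¬ IsCherryPair (lookup T j)
distinct-parents⇒¬cherry {H} N (step {r = cherry u v} red C) la lx qa→a qx→x qa≢qx fzero (r∋a , _) (r∋x , _) _
  with cherry-parent red
... | _ , lu , lv , p , p→u , p→v = qa≢qx (trans (sym (parent r∋a qa→a)) (parent r∋x qx→x))
  where
  parent : ∀ {y q} → Contains (cherry u v) y → Edge H q y → p ≡ q
  parent (inj₁ refl) = Network.leaf-parent-unique N lu p→u
  parent (inj₂ refl) = Network.leaf-parent-unique N lv p→v
distinct-parents⇒¬cherry N (step red C) la lx qa→a qx→x qa≢qx (fsuc j) foa fox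
  with first-there⁻ foa | first-there⁻ fox
... | foa′ , r∌a | fox′ , r∌x with leaf-persists N red la r∌a qa→a | leaf-persists N red lx r∌x qx→x
...   | _ , la′ , qa→a′ , _ | _ , lx′ , qx→x′ , _ =
  distinct-parents⇒¬cherry (network-preserved N red) C la′ lx′ qa→a′ qx→x′ qa≢qx j foa′ fox′

module _ {H : Graph} (N : IsNetwork H) where
  open Network N

  siblings-reduced-together : ∀ {r H′ a c q} → Reduction H r H′ → IsLeaf H a → IsLeaf H c → a ≢ c →
    Edge H q a → Edge H q c → Contains r a → Contains r c
  siblings-reduced-together {cherry u v} {a = a} {c} {q} red la lc a≢c q→a q→c r∋a with cherry-parent red
  ... | u≢v , lu , lv , p , p→u , p→v = reduced r∋a
    where
    children-q : ∀ {w} → Edge H q w → w ≡ a ⊎ w ≡ c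
    children-q = only-children (proj₁ (distinct-children q→a q→c a≢c)) q→a q→c a≢c
    reduced : Contains (cherry u v) a → Contains (cherry u v) c
    reduced (inj₁ refl) with leaf-parent-unique lu p→u q→a
    ... | refl with children-q p→v
    ...   | inj₁ v≡a = ⊥-elim (u≢v (sym v≡a))
    ...   | inj₂ v≡c = inj₂ (sym v≡c)
    reduced (inj₂ refl) with leaf-parent-unique lv p→v q→a
    ... | refl with children-q p→u
    ...   | inj₁ u≡a = ⊥-elim (u≢v u≡a)
    ...   | inj₂ u≡c = inj₁ (sym u≡c)
  siblings-reduced-together {ret u v} {a = a} {c} {q} red la lc a≢c q→a q→c r∋a with ret-shape red
  ... | lu , lv , pa , pb , _ , pa→u , pb→v , pa-ret , pb→pa , _ = ⊥-elim (impossible r∋a)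
    where
    q-outdeg : outdeg H q ≡ 2
    q-outdeg = proj₁ (distinct-children q→a q→c a≢c)
    -- the parent of a would be the reticulation pa (out-degree 1) or have pa as a leaf sibling of a
    impossible : Contains (ret u v) a → ⊥
    impossible (inj₁ refl) with leaf-parent-unique lu pa→u q→a
    ... | refl = case trans (sym q-outdeg) (proj₂ (proj₂ pa-ret)) of λ ()
    impossible (inj₂ refl) with leaf-parent-unique lv pb→v q→a
    ... | refl with only-children q-outdeg q→a q→c a≢c pb→pa
    ...   | inj₁ refl = reticulation⇒¬leaf pa-ret la
    ...   | inj₂ refl = reticulation⇒¬leaf pa-ret lc

siblings-first-together : ∀ {H T a c q} → IsNetwork H → CompleteReduction H T → IsLeaf H a → IsLeaf H c → a ≢ c →
  Edge H q a → Edge H q c → ∃ λ j → FirstOccurrence a T j × FirstOccurrence c T j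
siblings-first-together N (done sv) la lc a≢c _ _ = ⊥-elim (a≢c (single-vertex-unique sv (proj₁ la) (proj₁ lc)))
siblings-first-together {a = a} {c} N (step {r = r} red C) la lc a≢c q→a q→c with contains? r a | contains? r c
... | yes r∋a | _ = fzero , first-here r∋a , first-here (siblings-reduced-together N red la lc a≢c q→a q→c r∋a)
... | no r∌a | yes r∋c = ⊥-elim (r∌a (siblings-reduced-together N red lc la (λ c≡a → a≢c (sym c≡a)) q→c q→a r∋c))
... | no r∌a | no r∌c with leaf-persists N red la r∌a q→a | leaf-persists N red lc r∌c q→c
...   | _ , la′ , q→a′ , _ | _ , lc′ , q→c′ , _ with siblings-first-together (network-preserved N red) C la′ lc′ a≢c q→a′ q→c′
...     | j , foa , foc = fsuc j , first-there r∌a foa , first-there r∌c foc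

-- In a tree-child network the parent of a leaf a is of this kind whenever a is
-- the reticulation leaf of a reticulated cherry.
TreeChildParent : Graph → ℕ → ℕ → Set
TreeChildParent H q a = outdeg H q ≡ 2 × (∀ {z} → Edge H q z → z ≢ a → TreeOrLeaf H z)

treeChildParent⇒¬conflict : ∀ {H T a q} → IsNetwork H → CompleteReduction H T → IsLeaf H a → Edge H q a →
  TreeChildParent H q a → ¬ Conflict a T
treeChildParent⇒¬conflict N (done _) _ _ _ (inj₁ (() , _))
treeChildParent⇒¬conflict N (done _) _ _ _ (inj₂ (() , _))
treeChildParent⇒¬conflict {H} {a = a} {q} N (step {G' = H′} {r = r} {rs = T′} red C) la q→a (q-outdeg , siblings) conflict
  with contains? r a
... | yes r∋a = reduced-first conflict
  where
  open Network N
  r-cherry : ∀ {r′ H′} → Reduction H r′ H′ → Contains r′ a → ¬ IsRetPair r′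
  r-cherry red′ (inj₁ refl) (_ , _ , refl) with ret-shape red′
  ... | _ , _ , pa , _ , _ , pa→a , _ , pa-ret , _ with leaf-parent-unique la pa→a q→a
  ...   | refl = case trans (sym q-outdeg) (proj₂ (proj₂ pa-ret)) of λ ()
  r-cherry red′ (inj₂ refl) (_ , _ , refl) with ret-shape red′
  ... | _ , _ , pa , pb , _ , _ , pb→a , pa-ret , pb→pa , _ with leaf-parent-unique la pb→a q→a
  ...   | refl = treeOrLeaf⇒¬reticulation (siblings pb→pa (λ { refl → reticulation⇒¬leaf pa-ret la })) pa-ret
  reduced-first : Conflict a (r ∷ T′) → ⊥
  reduced-first (inj₁ (fzero , _ , ret-r)) = r-cherry red r∋a ret-r
  reduced-first (inj₁ (fsuc _ , fo , _)) = proj₂ (first-there⁻ fo) r∋a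
  reduced-first (inj₂ (_ , fzero , _ , s , _)) = ¬succ-zero s
  reduced-first (inj₂ (_ , fsuc _ , _ , _ , fo)) = proj₂ (first-there⁻ fo) r∋a
... | no r∌a with leaf-persists N red la r∌a q→a
...   | byp , la′ , q→a′ , q∈′ = later conflict
  where
  open Bypass byp
  N′ : IsNetwork H′
  N′ = network-preserved N red
  siblings′ : ∀ {z} → Edge H′ q z → z ≢ a → TreeOrLeaf H′ z
  siblings′ q→z′ z≢a with arc-origin q→z′
  ... | inj₁ q→z = treeOrLeaf′ (proj₂ (arcsInV′ q→z′)) (siblings q→z z≢a)
  ... | inj₂ (_ , _ , _ , _ , lz) = inj₂ (transfer (proj₂ (arcsInV′ q→z′)) lz)
  no-conflict′ : ¬ Conflict a T′
  no-conflict′ = treeChildParent⇒¬conflict N′ C la′ q→a′ (trans (outdeg-kept q∈′) q-outdeg , siblings′)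
  later : Conflict a (r ∷ T′) → ⊥
  later (inj₁ (fzero , fo , _)) = r∌a (proj₁ fo)
  later (inj₁ (fsuc j , fo , ret-j)) = no-conflict′ (inj₁ (j , proj₁ (first-there⁻ fo) , ret-j))
  later (inj₂ (_ , fzero , _ , s , _)) = ¬succ-zero s
  later (inj₂ (fsuc i , fsuc j , ret-i , s , fo)) = no-conflict′ (inj₂ (i , j , ret-i , succ-tail⁻ s , proj₁ (first-there⁻ fo)))
  -- r = (u , w) itself has its successor at the first occurrence of a; there a and
  -- u are reduced together although their parents q and q′ in H′ differ.
  later (inj₂ (fzero , fsuc j , (u , w , refl) , s , fo)) with ret-shape red
  ... | lu , _ , pa , _ , q′ , pa→u , _ , pa-ret , _ , q′→pa , q′→u′ with pair-kind (lookup T′ j)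
  ...   | inj₂ ret-j = no-conflict′ (inj₁ (j , proj₁ (first-there⁻ fo) , ret-j))
  ...   | inj₁ cherry-j = distinct-parents⇒¬cherry N′ C la′ (transfer (proj₂ (arcsInV′ q′→u′)) lu) q→a′ q′→u′ q≢q′ j
                            (proj₁ (first-there⁻ fo)) (succ-head⁻ s) cherry-j
    where
    q≢q′ : q ≢ q′
    q≢q′ refl = Network.treeOrLeaf⇒¬reticulation N (siblings q′→pa (λ { refl → Network.reticulation⇒¬leaf N pa-ret la })) pa-ret

ReticulationNear : Graph → ℕ → ℕ → Set
ReticulationNear H q a = IsReticulation H q ⊎ ∃ λ z → Edge H q z × z ≢ a × IsReticulation H z

reticulationNear⇒conflict : ∀ {H T a q} → IsNetwork H → CompleteReduction H T → IsLeaf H a → Edge H q a →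
  ReticulationNear H q a → Conflict a T
reticulationNear⇒conflict N (done sv) _ q→a _ = ⊥-elim (single-vertex-no-arc sv q→a)
reticulationNear⇒conflict {H} {a = a} {q} N (step {G' = H′} {r = r} {rs = T′} red C) la q→a near with contains? r a
... | yes r∋a = inj₁ (fzero , first-here r∋a , r-ret red r∋a near)
  where
  open Network N
  q-not-near : ∀ {p a′} → p ≡ q → Edge H p a′ → a ≢ a′ → IsLeaf H a′ → ¬ ReticulationNear H q a
  q-not-near refl p→a′ a≢a′ la′ (inj₁ q-ret) = a≢a′ (unique-child (proj₂ (proj₂ q-ret)) q→a p→a′)
  q-not-near refl p→a′ a≢a′ la′ (inj₂ (z , q→z , z≢a , z-ret))
    with only-children (proj₁ (distinct-children q→a p→a′ a≢a′)) q→a p→a′ a≢a′ q→z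
  ... | inj₁ z≡a = z≢a z≡a
  ... | inj₂ refl = reticulation⇒¬leaf z-ret la′
  r-ret : ∀ {r′} → Reduction H r′ H′ → Contains r′ a → ReticulationNear H q a → IsRetPair r′
  r-ret {ret u v} _ _ _ = u , v , refl
  r-ret {cherry u v} red′ r∋a′ near′ with cherry-parent red′
  ... | u≢v , lu , lv , p , p→u , p→v with r∋a′
  ...   | inj₁ refl = ⊥-elim (q-not-near (leaf-parent-unique lu p→u q→a) p→v u≢v lv near′)
  ...   | inj₂ refl = ⊥-elim (q-not-near (leaf-parent-unique lv p→v q→a) p→u (λ v≡u → u≢v (sym v≡u)) lu near′)
... | no r∌a with leaf-persists N red la r∌a q→a
...   | byp , la′ , q→a′ , q∈′ = later near
  where
  open Bypass byp
  N′ : IsNetwork H′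
  N′ = network-preserved N red
  -- r = (z′ , w) with z′ a new sibling of a, so the successor of r is the first occurrence of a
  via-sibling : ∀ {z} → IsReticulation H z →
    (∃ λ z′ → Edge H′ q z′ × IsLeaf H z′ × Contains r z′ × (IsTreeVertex H z ⊎ ∃ λ w → r ≡ ret z′ w)) → Conflict a (r ∷ T′)
  via-sibling z-ret (_ , _ , _ , _ , inj₁ z-tree) = ⊥-elim (Network.tree⇒¬reticulation N z-tree z-ret)
  via-sibling _ (z′ , q→z′ , lz′ , r∋z′ , inj₂ (w , refl))
    with siblings-first-together N′ C la′ (transfer (proj₂ (arcsInV′ q→z′)) lz′) (λ { refl → r∌a r∋z′ }) q→a′ q→z′
  ... | j , foa , foz′ = inj₂ (fzero , fsuc j , (z′ , w , refl) , succ-head foz′ , first-there r∌a foa)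
  later : ReticulationNear H q a → Conflict a (r ∷ T′)
  later (inj₁ q-ret) = conflict-there r∌a (reticulationNear⇒conflict N′ C la′ q→a′ (inj₁ (transfer q∈′ q-ret)))
  later (inj₂ (z , q→z , z≢a , z-ret)) with z ≟ del₁ | z ≟ del₂
  ... | no z≢d₁ | no z≢d₂ = conflict-there r∌a
        (reticulationNear⇒conflict N′ C la′ q→a′ (inj₂ (z , keeps-arc q→z q∈′ z∈′ , z≢a , transfer z∈′ z-ret)))
    where
      z∈′ : z ∈ V H′
      z∈′ = V⇒V′ (Network.target∈V N q→z) z≢d₁ z≢d₂
  ... | yes z≡d₁ | _ = via-sibling z-ret (bypass q∈′ q→z (inj₁ z≡d₁))
  ... | no _ | yes z≡d₂ = via-sibling z-ret (bypass q∈′ q→z (inj₂ z≡d₂))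

-- Tree-child networks and tree-child sequences

ret-leaf-no-conflict : ∀ {G G′ T a b} → IsNetwork G → IsTreeChild G → Reduction G (ret a b) G′ →
  CompleteReduction G′ T → ¬ Conflict a T
ret-leaf-no-conflict {G} {G′} {a = a} N tc
  red@(a≢b , la , lb , _ , uA′ , pa , pb , q , g , pa→a , pb→b , pa-ret , pb→pa , q→pa , q≢pb , g→pb , V′⇔ , A′⇔) C =
  treeChildParent⇒¬conflict (network-preserved {r = ret a _} N red) C (transfer a∈′ la) R.q→a′ (trans (outdeg-kept q∈′) q-outdeg , siblings′)
  where
  open Network N
  module R = RetBypass N a≢b la lb uA′ pa→a pb→b pa-ret pb→pa q→pa q≢pb g→pb V′⇔ A′⇔
  open Bypass R.bypass
  q∈′ : q ∈ V G′
  q∈′ = proj₁ (arcsInV′ R.q→a′)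
  a∈′ : a ∈ V G′
  a∈′ = proj₂ (arcsInV′ R.q→a′)
  u-child : ∃ λ u → Edge G q u × TreeOrLeaf G u
  u-child = tc q (source∈V q→pa) (λ o → no-child o q→pa)
  pa≢u : pa ≢ proj₁ u-child
  pa≢u pa≡u = treeOrLeaf⇒¬reticulation (subst (TreeOrLeaf G) (sym pa≡u) (proj₂ (proj₂ u-child))) pa-ret
  q-outdeg : outdeg G q ≡ 2
  q-outdeg = proj₁ (distinct-children q→pa (proj₁ (proj₂ u-child)) pa≢u)
  siblings′ : ∀ {z} → Edge G′ q z → z ≢ a → TreeOrLeaf G′ z
  siblings′ q→z′ _ with arc-origin q→z′
  ... | inj₂ (_ , _ , _ , _ , lz) = inj₂ (transfer (proj₂ (arcsInV′ q→z′)) lz)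
  ... | inj₁ q→z with only-children q-outdeg q→pa (proj₁ (proj₂ u-child)) pa≢u q→z
  ...   | inj₁ z≡pa = ⊥-elim (proj₁ (proj₂ (V′⇒V (proj₂ (arcsInV′ q→z′)))) z≡pa)
  ...   | inj₂ z≡u  = treeOrLeaf′ (proj₂ (arcsInV′ q→z′)) (subst (TreeOrLeaf G) (sym z≡u) (proj₂ (proj₂ u-child)))

treeChild⇒treeChildSeq : ∀ {G S} → IsNetwork G → IsTreeChild G → CompleteReduction G S → TreeChildSeq S
treeChild⇒treeChildSeq N tc (done _) = treeChildSeq-[]
treeChild⇒treeChildSeq N tc (step red C) =
  treeChildSeq-∷ (treeChild⇒treeChildSeq (network-preserved N red) (treeChild-preserved N tc red) C)
                 (λ { refl → ret-leaf-no-conflict N tc red C })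

module TreeChildBeforeBypass {G G′ r T} (N : IsNetwork G) (N′ : IsNetwork G′) (byp : Bypass r G G′)
  (C : CompleteReduction G′ T) (tc′ : IsTreeChild G′) (head-ok : ∀ {a b} → r ≡ ret a b → ¬ Conflict a T) where
  open Bypass byp
  open Network N

  branching : ∀ {v m z′} → v ∈ V G′ → Edge G v m → ¬ ReticulationNear G′ v z′ → outdeg G v ≡ 2
  branching v∈′ v→m no-near with kind (proj₁ (V′⇒V v∈′))
  ... | reticulation i o = ⊥-elim (no-near (inj₁ (transfer v∈′ (proj₁ (V′⇒V v∈′) , i , o))))
  ... | leaf _ o         = ⊥-elim (no-child o v→m)
  ... | isolated _ o     = ⊥-elim (no-child o v→m)
  ... | root _ o         = o
  ... | tree _ o         = o

  -- A reticulation at v or among its other children would give a conflict at z′.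
  other-child-treeOrLeaf : ∀ {v m z′} → v ∈ V G′ → Edge G v m → IsReticulation G m →
    (∀ {d} → OneOf del₁ del₂ d → IsReticulation G d → d ≡ m) → Edge G′ v z′ → IsLeaf G z′ →
    ¬ ReticulationNear G′ v z′ → ∃ λ u → Edge G v u × TreeOrLeaf G u
  other-child-treeOrLeaf {v} {m} {z′} v∈′ v→m m-ret m-unique v→z′ lz′ no-near
    with other-child (branching v∈′ v→m no-near) v→m
  ... | y , v→y , y≢m with y ≟ z′ | deleted? y
  ...   | yes refl | _ = y , v→y , inj₂ lz′
  ...   | no _ | inj₁ y-del with deleted-kind y-del
  ...     | inj₁ tl = y , v→y , tl
  ...     | inj₂ (y-ret , _) = ⊥-elim (y≢m (m-unique y-del y-ret))
  other-child-treeOrLeaf {v} {m} {z′} v∈′ v→m m-ret m-unique v→z′ lz′ no-near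
    | y , v→y , y≢m | no y≢z′ | inj₂ (y≢d₁ , y≢d₂) with target-kind v→y
  ... | leaf i o         = y , v→y , inj₂ (target∈V v→y , i , o)
  ... | tree i o         = y , v→y , inj₁ (target∈V v→y , i , o)
  ... | reticulation i o = ⊥-elim (no-near (inj₂ (y , keeps-arc v→y v∈′ y∈′ , y≢z′ , transfer y∈′ (target∈V v→y , i , o))))
    where
      y∈′ : y ∈ V G′
      y∈′ = V⇒V′ (target∈V v→y) y≢d₁ y≢d₂
  ... | root i _         = ⊥-elim (no-parent i v→y)
  ... | isolated i _     = ⊥-elim (no-parent i v→y)

  survivor-has-treeOrLeaf-child : ∀ {v} → v ∈ V G′ → outdeg G v ≢ 0 → ∃ λ u → Edge G v u × TreeOrLeaf G u
  survivor-has-treeOrLeaf-child {v} v∈′ o with tc′ v v∈′ (λ o′ → o (trans (sym (outdeg-kept v∈′)) o′))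
  ... | u , v→u′ , tl′ with arc-origin v→u′
  ...   | inj₁ v→u = u , v→u , treeOrLeaf⁻ tl′
  ...   | inj₂ (m , v→m , _ , m-del , _) with deleted-kind m-del
  ...     | inj₁ tl = m , v→m , tl
  ...     | inj₂ (m-ret , m-unique) with bypass v∈′ v→m m-del
  ...       | _ , _ , _ , _ , inj₁ m-tree = ⊥-elim (tree⇒¬reticulation m-tree m-ret)
  ...       | z′ , v→z′ , lz′ , _ , inj₂ (_ , r≡) = other-child-treeOrLeaf v∈′ v→m m-ret m-unique v→z′ lz′
                λ near → head-ok r≡ (reticulationNear⇒conflict N′ C (transfer (proj₂ (arcsInV′ v→z′)) lz′) v→z′ near)

  treeChild : IsTreeChild G
  treeChild v v∈ o with deleted? v
  ... | inj₁ v-del = let w , v→w , lw = deleted-leaf-child v-del o in w , v→w , inj₂ lw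
  ... | inj₂ (v≢d₁ , v≢d₂) = survivor-has-treeOrLeaf-child (V⇒V′ v∈ v≢d₁ v≢d₂) o

treeChildSeq⇒treeChild : ∀ {G S} → IsNetwork G → CompleteReduction G S → TreeChildSeq S → IsTreeChild G
treeChildSeq⇒treeChild N (done sv) _ _ _ o = ⊥-elim (o (single-vertex-outdeg sv))
treeChildSeq⇒treeChild {G} N (step {G' = G′} red C) tcs with reduction-view N red
... | inj₁ byp = TreeChildBeforeBypass.treeChild N N′ byp C (treeChildSeq⇒treeChild N′ C (treeChildSeq-tail tcs))
                   (λ { refl → treeChildSeq-head tcs })
  where
    N′ : IsNetwork G′
    N′ = network-preserved N red
... | inj₂ fin = treeChild
  where
  open FinalCherry fin
  treeChild : IsTreeChild G
  treeChild v v∈ o with vertices v∈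
  ... | inj₁ refl        = ⊥-elim (o (proj₂ (proj₂ la)))
  ... | inj₂ (inj₁ refl) = a , p→a , inj₂ la
  ... | inj₂ (inj₂ refl) = ⊥-elim (o (proj₂ (proj₂ lb)))

-- Existence of a complete reduction

Avoids : ℕ → ℕ → ℕ → Set
Avoids d₁ d₂ x = x ≢ d₁ × x ≢ d₂

avoids? : ∀ d₁ d₂ x → Dec (Avoids d₁ d₂ x)
avoids? d₁ d₂ x = ¬? (x ≟ d₁) ×-dec ¬? (x ≟ d₂)

notIncident? : ∀ x y e → Dec (NotIncident x y e)
notIncident? x y e = ¬? (proj₁ e ≟ x) ×-dec ¬? (proj₂ e ≟ x) ×-dec ¬? (proj₁ e ≟ y) ×-dec ¬? (proj₂ e ≟ y)

∈-avoiding : ∀ {vs : List ℕ} d₁ d₂ x → (x ∈ filter (avoids? d₁ d₂) vs) ⇔ ((x ∈ vs) × (x ≢ d₁) × (x ≢ d₂))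
∈-avoiding {vs} d₁ d₂ x = mk⇔ (∈-filter⁻ (avoids? d₁ d₂) {xs = vs}) (λ (x∈ , avoids) → ∈-filter⁺ (avoids? d₁ d₂) x∈ avoids)

avoiding-shorter : ∀ {vs : List ℕ} d₁ d₂ → d₁ ∈ vs → length (filter (avoids? d₁ d₂) vs) < length vs
avoiding-shorter {vs} d₁ d₂ d₁∈ = filter-notAll (avoids? d₁ d₂) vs (Any.map (λ d₁≡x avoids → proj₁ avoids (sym d₁≡x)) d₁∈)

∈-notIncident : ∀ {as : List Arc} x y e → (e ∈ filter (notIncident? x y) as) ⇔ ((e ∈ as) × NotIncident x y e)
∈-notIncident {as} x y e = mk⇔ (∈-filter⁻ (notIncident? x y) {xs = as}) (λ (e∈ , ni) → ∈-filter⁺ (notIncident? x y) e∈ ni)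

Shrinks : Graph → Set
Shrinks G = ∃ λ r → ∃ λ G′ → Reduction G r G′ × length (V G′) < length (V G)

module Shrink {G : Graph} (N : IsNetwork G) where
  open Network N

  reduce-cherry : ∀ {a b p} → a ≢ b → IsLeaf G a → IsLeaf G b → Edge G p a → Edge G p b → Shrinks G
  reduce-cherry {a} {b} {p} a≢b la lb p→a p→b with indeg G p ≟ 0
  ... | yes p-parentless = cherry a b , graph V′ (filter (notIncident? a p) (A G)) ,
        (a≢b , la , lb , filter⁺ (avoids? a p) uniqueV , filter⁺ (notIncident? a p) uniqueA , p , p→a , p→b ,
         ∈-avoiding a p , inj₁ (p-parentless , ∈-notIncident a p)) ,
        avoiding-shorter a p (proj₁ la)
    where
      V′ : List ℕ
      V′ = filter (avoids? a p) (V G)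
  ... | no p-has-parent with has-parent p-has-parent
  ...   | g , g→p = cherry a b , graph V′ ((g , b) ∷ kept) ,
          (a≢b , la , lb , filter⁺ (avoids? a p) uniqueV , ¬Any⇒All¬ _ gb∉ ∷ filter⁺ (notIncident? a p) uniqueA ,
           p , p→a , p→b , ∈-avoiding a p , inj₂ (g , g→p , A′⇔)) ,
          avoiding-shorter a p (proj₁ la)
    where
    V′ : List ℕ
    V′ = filter (avoids? a p) (V G)
    kept : List Arc
    kept = filter (notIncident? a p) (A G)
    gb∉ : (g , b) ∉ kept
    gb∉ gb∈ = arc-≢ g→p (leaf-parent-unique lb (proj₁ (∈-filter⁻ (notIncident? a p) {xs = A G} gb∈)) p→b)
    A′⇔ : ∀ e → (e ∈ (g , b) ∷ kept) ⇔ (((e ∈ A G) × NotIncident a p e) ⊎ (e ≡ (g , b)))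
    A′⇔ e = mk⇔ (λ { (here e≡) → inj₂ e≡ ; (there e∈) → inj₁ (∈-filter⁻ (notIncident? a p) {xs = A G} e∈) })
                (λ { (inj₂ e≡) → here e≡ ; (inj₁ (e∈ , ni)) → there (∈-filter⁺ (notIncident? a p) e∈ ni) })

  reduce-ret : ∀ {a b pa pb q g} → a ≢ b → IsLeaf G a → IsLeaf G b → Edge G pa a → Edge G pb b → IsReticulation G pa →
    Edge G pb pa → Edge G q pa → q ≢ pb → Edge G g pb → Shrinks G
  reduce-ret {a} {b} {pa} {pb} {q} {g} a≢b la lb pa→a pb→b pa-ret pb→pa q→pa q≢pb g→pb =
    ret a b , graph V′ ((g , b) ∷ (q , a) ∷ kept) ,
    (a≢b , la , lb , filter⁺ (avoids? pa pb) uniqueV ,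
     ¬Any⇒All¬ _ gb∉ ∷ ¬Any⇒All¬ _ qa∉ ∷ filter⁺ (notIncident? pa pb) uniqueA ,
     pa , pb , q , g , pa→a , pb→b , pa-ret , pb→pa , q→pa , q≢pb , g→pb , ∈-avoiding pa pb , A′⇔) ,
    avoiding-shorter pa pb (proj₁ pa-ret)
    where
    V′ : List ℕ
    V′ = filter (avoids? pa pb) (V G)
    kept : List Arc
    kept = filter (notIncident? pa pb) (A G)
    gb∉ : (g , b) ∉ (q , a) ∷ kept
    gb∉ (here gb≡qa) = a≢b (sym (,-injectiveʳ gb≡qa))
    gb∉ (there gb∈) = arc-≢ g→pb (leaf-parent-unique lb (proj₁ (∈-filter⁻ (notIncident? pa pb) {xs = A G} gb∈)) pb→b)
    qa∉ : (q , a) ∉ kept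
    qa∉ qa∈ = arc-≢ q→pa (leaf-parent-unique la (proj₁ (∈-filter⁻ (notIncident? pa pb) {xs = A G} qa∈)) pa→a)
    A′⇔ : ∀ e → (e ∈ (g , b) ∷ (q , a) ∷ kept) ⇔ (((e ∈ A G) × NotIncident pa pb e) ⊎ (e ≡ (g , b)) ⊎ (e ≡ (q , a)))
    A′⇔ e = mk⇔ (λ { (here e≡) → inj₂ (inj₁ e≡) ; (there (here e≡)) → inj₂ (inj₂ e≡)
                   ; (there (there e∈)) → inj₁ (∈-filter⁻ (notIncident? pa pb) {xs = A G} e∈) })
                (λ { (inj₂ (inj₁ e≡)) → here e≡ ; (inj₂ (inj₂ e≡)) → there (here e≡)
                   ; (inj₁ (e∈ , ni)) → there (there (∈-filter⁺ (notIncident? pa pb) e∈ ni)) })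

path-first : ∀ {G u w} → Path G u w → ∃ λ x → Edge G u x × (x ≡ w ⊎ Path G x w)
path-first (arc u→w) = _ , u→w , inj₁ refl
path-first (u→x ∷ₚ p) = _ , u→x , inj₂ p

module ShrinkTreeChild {G : Graph} (N : IsNetwork G) (tc : IsTreeChild G) where
  open Network N
  open Shrink N

  reachable : ∀ {ρ v} → ρ ∈ V G → indeg G ρ ≡ 0 → v ∈ V G → v ≢ ρ → ¬ ¬ Path G ρ v
  reachable {ρ} {v} ρ∈ ρ-parentless v∈ v≢ρ no-path
    with descent (V G) (λ x y → Path G y x) (λ p q → q ++ₚ p) Unreached proj₁ ascend (v∈ , v≢ρ , no-path)
    where
    Unreached : ℕ → Set
    Unreached x = x ∈ V G × x ≢ ρ × ¬ Path G ρ x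
    ascend : ∀ x → Unreached x → ⊥ ⊎ ∃ λ u → Unreached u × Path G u x
    ascend x (x∈ , x≢ρ , x-unreached) with has-parent (λ i → x≢ρ (indeg≡0-unique x∈ ρ∈ i ρ-parentless))
    ... | u , u→x with u ≟ ρ
    ...   | yes refl = inj₁ (x-unreached (arc u→x))
    ...   | no u≢ρ  = inj₂ (u , (source∈V u→x , u≢ρ , λ ρ⇝u → x-unreached (ρ⇝u ++ₚ arc u→x)) , arc u→x)
  ... | inj₂ (x , cycle) = acyclic x cycle

  Branching : ℕ → Set
  Branching v = v ∈ V G × outdeg G v ≡ 2

  -- v has the leaf child u and the reticulation child c, whose own child w is a leaf:
  -- (w , u) is a reticulated cherry unless v is the root, which cannot happen since
  -- the other parent of c would be reachable from the root only through c.
  below-reticulation : ∀ {v u c w} → Branching v → Edge G v u → IsLeaf G u → Edge G v c → c ≢ u →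
    IsReticulation G c → Edge G c w → IsLeaf G w → Shrinks G
  below-reticulation {v} {u} {c} {w} (v∈ , o) v→u lu v→c c≢u c-ret c→w lw
    with other-parent (proj₁ (proj₂ c-ret)) v→c | indeg G v ≟ 0
  ... | q , q→c , q≢v | no v-has-parent =
        let g , g→v = has-parent v-has-parent in reduce-ret w≢u lw lu c→w v→u c-ret v→c q→c q≢v g→v
    where
    w≢u : w ≢ u
    w≢u refl = arc-≢ v→c (leaf-parent-unique lu v→u c→w)
  ... | q , q→c , q≢v | yes v-parentless = ⊥-elim (reachable v∈ v-parentless (source∈V q→c) q≢v no-path)
    where
    no-path : ¬ Path G v q
    no-path v⇝q with path-first v⇝q
    ... | x , v→x , rest with only-children o v→u v→c (λ u≡c → c≢u (sym u≡c)) v→x | rest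
    ...   | inj₁ refl | inj₁ refl = leaf-no-child lu q→c
    ...   | inj₁ refl | inj₂ u⇝q = leaf-no-child lu (proj₁ (proj₂ (path-first u⇝q)))
    ...   | inj₂ refl | inj₁ refl = arc-≢ q→c refl
    ...   | inj₂ refl | inj₂ c⇝q = acyclic x (c⇝q ++ₚ arc q→c)

  beside-leaf : ∀ {v u c} → Branching v → Edge G v u → IsLeaf G u → Edge G v c → c ≢ u →
    Shrinks G ⊎ ∃ λ w → Branching w × Path G v w
  beside-leaf bv v→u lu v→c c≢u with target-kind v→c
  ... | leaf i o      = inj₁ (reduce-cherry (λ u≡c → c≢u (sym u≡c)) lu (target∈V v→c , i , o) v→u v→c)
  ... | tree _ o      = inj₂ (_ , (target∈V v→c , o) , arc v→c)
  ... | root i _      = ⊥-elim (no-parent i v→c)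
  ... | isolated i _  = ⊥-elim (no-parent i v→c)
  ... | reticulation i o with tc _ (target∈V v→c) (λ o′ → case trans (sym o) o′ of λ ())
  ...   | w , c→w , inj₁ (w∈ , _ , w-outdeg) = inj₂ (w , (w∈ , w-outdeg) , (v→c ∷ₚ arc c→w))
  ...   | w , c→w , inj₂ lw = inj₁ (below-reticulation bv v→u lu v→c c≢u (target∈V v→c , i , o) c→w lw)

  descend : ∀ v → Branching v → Shrinks G ⊎ ∃ λ w → Branching w × Path G v w
  descend v (v∈ , o) with tc v v∈ (λ o′ → case trans (sym o) o′ of λ ())
  ... | u , v→u , inj₁ (u∈ , _ , u-outdeg) = inj₂ (u , (u∈ , u-outdeg) , arc v→u)
  ... | u , v→u , inj₂ lu with other-child o v→u
  ...   | c , v→c , c≢u = beside-leaf (v∈ , o) v→u lu v→c c≢u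

  shrink : SingleVertex G ⊎ Shrinks G
  shrink with shape
  ... | inj₁ sv = inj₁ sv
  ... | inj₂ (ρ , (ρ∈ , _ , o) , _) with descent (V G) (Path G) _++ₚ_ Branching proj₁ descend (ρ∈ , o)
  ...   | inj₁ s = inj₂ s
  ...   | inj₂ (x , cycle) = ⊥-elim (acyclic x cycle)

complete-reduction : ∀ n G → length (V G) ≤ n → IsNetwork G → IsTreeChild G → ∃ (CompleteReduction G)
complete-reduction n G size≤n N tc with ShrinkTreeChild.shrink N tc
... | inj₁ sv = [] , done sv
... | inj₂ (r , G′ , red , smaller) with n
...   | zero = case ≤-trans smaller size≤n of λ ()
...   | suc n′ with complete-reduction n′ G′ (≤-pred (≤-trans smaller size≤n)) (network-preserved N red) (treeChild-preserved N tc red)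
...     | S , C = r ∷ S , step red C

theorem3p3 : (X : List ℕ) → X ≢ [] → (R : Graph) → IsNetworkOn X R →
    IsTreeChild R ⇔ (∃[ S ] CompleteReduction R S × TreeChildSeq S)
theorem3p3 _ _ R (N , _) = mk⇔
  (λ tc → let S , C = complete-reduction (length (V R)) R ≤-refl N tc in S , C , treeChild⇒treeChildSeq N tc C)
  (λ (S , C , tcs) → treeChildSeq⇒treeChild N C tcs)
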